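{- Let $r\geq 1$ and $D\geq 3$ be integers, $N:=\lfloor \frac{(D-1)r}{2}\rfloor$, $k:=\lfloor\frac{D-1}{2}\rfloor$, $\bar k:=\lceil\frac{D-1}{2}\rceil$. Let $\alpha_1<\cdots<\alpha_{r(D-1)}$ be integers with $\alpha_1\geq2$ such that $\alpha_t$ is odd for $1\leq t\leq N$ and $\alpha_t$ is even for $N+1\leq t\leq r(D-1)$. Then $$\tilde\Delta_{r,D}(\underline{\alpha})=C\,\tilde\Delta'_{r,D}(\underline{\alpha})\,\tilde\Delta''_{r,D}(\underline{\alpha})$$ for some constant $C\neq 0$. In particular, if $\tilde\Delta'_{r,D}(\underline{\alpha})\neq0$ and $\tilde\Delta''_{r,D}(\underline{\alpha})\neq0$, then $\tilde\Delta_{r,D}(\underline{\alpha})\neq 0$.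
   Context: The Bernoulli polynomials $B_n(x)$ are defined by $\frac{ze^{xz}}{e^z-1}=\sum_{n\geq 0}B_n(x)\frac{z^n}{n!}$, $B_n=B_n(0)$, and $\tilde B_n(x):=D^n(B_n(x)-B_n)$. $\tilde\Delta_{r,D}(\underline{\alpha})$ is the determinant of the $r(D-1)\times r(D-1)$ matrix with rows indexed by $t=1,\ldots,r(D-1)$, columns indexed by pairs $(m,v)$, $0\leq m\leq r-1$, $1\leq v\leq D-1$ (ordered with $m$ first, then $v$), and entries $\frac{\tilde B_{\alpha_t+m}(v/D)}{\alpha_t+m}$. $\tilde\Delta'_{r,D}(\underline{\alpha})$ is the determinant of the $N\times N$ matrix with rows $t=1,\ldots,N$, columns indexed by pairs $(m,v)$ with $0\leq m\leq r-1$ and $1\leq v\leq k$ if $m$ is even, $1\leq v\leq \bar k$ if $m$ is odd (ordered with $m$ first, then $v$), and entries $\frac{\tilde B_{\alpha_t+m}(v/D)}{\alpha_t+m}$. $\tilde\Delta''_{r,D}(\underline{\alpha})$ is the determinant of the $(r(D-1)-N)\times(r(D-1)-N)$ matrix with rows $t=N+1,\ldots,r(D-1)$, columns indexed by pairs $(m,v)$ with $0\leq m\leq r-1$ and $1\leq v\leq \bar k$ if $m$ is even, $1\leq v\leq k$ if $m$ is odd (ordered with $m$ first, then $v$), and entries $\frac{\tilde B_{\alpha_t+m}(v/D)}{\alpha_t+m}$. -}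

module Defs where

open import Data.Nat as ℕ using (ℕ; zero; suc; ⌊_/2⌋; ⌈_/2⌉; _∸_; _<_; _≤_)
open import Data.Nat.Combinatorics using (_C_)
open import Data.Integer using (+_)
open import Data.Rational using (ℚ; 0ℚ; 1ℚ; _+_; _*_; -_; _-_; _/_)
open import Data.Fin using (Fin; toℕ; fromℕ)
open import Data.Vec as Vec using (Vec; []; _∷_; _∷ʳ_)
open import Data.List as List using (List; []; _∷_; upTo; map; concatMap; removeAt; allFin; length; take; drop)
open import Data.Bool using (Bool; true; false; if_then_else_)
open import Data.Product using (_×_; _,_)

ℕtoℚ : ℕ → ℚ
ℕtoℚ n = (+ n) / 1

-- 1/n for n ≥ 1 (junk value 0 at n = 0; only used at positive n)
invℕ : ℕ → ℚ
invℕ zero = 0ℚ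
invℕ (suc n) = (+ 1) / suc n

_^ℚ_ : ℚ → ℕ → ℚ
x ^ℚ zero = 1ℚ
x ^ℚ suc n = x * (x ^ℚ n)

sumFin : (n : ℕ) → (Fin n → ℚ) → ℚ
sumFin zero f = 0ℚ
sumFin (suc n) f = f Fin.zero + sumFin n (λ i → f (Fin.suc i))

sgn : ℕ → ℚ
sgn zero = 1ℚ
sgn (suc n) = - sgn n

-- Bernoulli numbers B_0 .. B_n (convention B_1 = -1/2, as from z/(e^z-1)),
-- via the recurrence  sum_{j=0}^{m} C(m+1,j) B_j = 0  (m ≥ 1), B_0 = 1.
bernVec : (n : ℕ) → Vec ℚ (suc n)
bernVec zero = 1ℚ ∷ []
bernVec (suc n) =
  let v = bernVec n in
  v ∷ʳ (- (invℕ (suc (suc n)) *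
          sumFin (suc n) (λ j → ℕtoℚ (suc (suc n) C toℕ j) * Vec.lookup v j)))

bern : ℕ → ℚ
bern n = Vec.lookup (bernVec n) (fromℕ n)

bernPoly : ℕ → ℚ → ℚ
bernPoly n x = sumFin (suc n) (λ j → ℕtoℚ (n C toℕ j) * bern (toℕ j) * (x ^ℚ (n ∸ toℕ j)))

bernTilde : (D n : ℕ) → ℚ → ℚ
bernTilde D n x = (ℕtoℚ D ^ℚ n) * (bernPoly n x - bern n)

-- matrix entry  \tilde B_{a+m}(v/D) / (a+m)  for row value a = α_t, column (m , v)
entry : (D : ℕ) → ℕ → ℕ × ℕ → ℚ
entry D a (m , v) =
  bernTilde D (a ℕ.+ m) (ℕtoℚ v * invℕ D) * invℕ (a ℕ.+ m)

-- Determinant of the matrix (f x c) with rows indexed by the list xs and columns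
-- by the list cs (in the given orders), by Laplace expansion along the first row.
-- (Non-square inputs give 0; all uses below are square.)
detL : {R Col : Set} → (R → Col → ℚ) → List R → List Col → ℚ
detL f [] [] = 1ℚ
detL f [] (_ ∷ _) = 0ℚ
detL f (x ∷ xs) cs =
  sumFin (length cs) (λ j →
    sgn (toℕ j) * f x (List.lookup cs j) * detL f xs (removeAt cs j))

isEven : ℕ → Bool
isEven zero = true
isEven (suc zero) = false
isEven (suc (suc n)) = isEven n

oneTo : ℕ → List ℕ
oneTo n = map suc (upTo n)

kk : ℕ → ℕ
kk D = ⌊ D ∸ 1 /2⌋

kbar : ℕ → ℕ
kbar D = ⌈ D ∸ 1 /2⌉

NN : ℕ → ℕ → ℕ
NN r D = ⌊ (D ∸ 1) ℕ.* r /2⌋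

colsΔ : ℕ → ℕ → List (ℕ × ℕ)
colsΔ r D = concatMap (λ m → map (λ v → (m , v)) (oneTo (D ∸ 1))) (upTo r)

colsΔ′ : ℕ → ℕ → List (ℕ × ℕ)
colsΔ′ r D = concatMap (λ m → map (λ v → (m , v))
               (oneTo (if isEven m then kk D else kbar D))) (upTo r)

colsΔ″ : ℕ → ℕ → List (ℕ × ℕ)
colsΔ″ r D = concatMap (λ m → map (λ v → (m , v))
               (oneTo (if isEven m then kbar D else kk D))) (upTo r)

-- the list (α_1, ..., α_{r(D-1)}) ; α is 0-indexed: α_t = α (t-1)
rowsOf : (n : ℕ) → (Fin n → ℕ) → List ℕ
rowsOf n α = map α (allFin n)

Δ̃ : (r D : ℕ) → (Fin (r ℕ.* (D ∸ 1)) → ℕ) → ℚ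
Δ̃ r D α = detL (entry D) (rowsOf _ α) (colsΔ r D)

Δ̃′ : (r D : ℕ) → (Fin (r ℕ.* (D ∸ 1)) → ℕ) → ℚ
Δ̃′ r D α = detL (entry D) (take (NN r D) (rowsOf _ α)) (colsΔ′ r D)

Δ̃″ : (r D : ℕ) → (Fin (r ℕ.* (D ∸ 1)) → ℕ) → ℚ
Δ̃″ r D α = detL (entry D) (drop (NN r D) (rowsOf _ α)) (colsΔ″ r D)

-- The reflection Bₙ(1 - x) = (-1)ⁿ Bₙ(x), together with Bₙ = 0 for odd n ≥ 3, relates the
-- columns (m , v) and (m , D - v): their entries in row t agree when αₜ + m is even and are
-- opposite when αₜ + m is odd (note αₜ + m ≥ 2). Replacing, for each m and each v < D / 2, this
-- pair of columns by its half sum and half difference multiplies the determinant by -1/2.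
-- In an odd row αₜ the half sums vanish for m even and the half differences for m odd, as does
-- the self-mirrored column v = D / 2 for m even; in an even row the other half of each pair
-- vanishes instead, and the surviving halves reproduce the original entries. So after a
-- reordering of the columns the matrix is block triangular, the first N rows being zero on the
-- columns of Δ̃″, and its diagonal blocks are exactly the matrices of Δ̃′ and Δ̃″.

module Submission where

open import Defs
open import Data.Nat as ℕ using (ℕ; zero; suc; _≤_; _<_; z≤n; s≤s; _∸_; ⌊_/2⌋; ⌈_/2⌉)
import Data.Nat.Properties as ℕP
open import Data.Nat.Combinatorics using (_C_; nCk+nC[k+1]≡[n+1]C[k+1]; k>n⇒nCk≡0; nCk≡nC[n∸k]; nCn≡1; nC1≡n)
open import Data.Integer as ℤ using ()
import Data.Integer.Properties as ℤP
open import Data.Fin as Fin using (Fin; toℕ)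
open import Data.Fin.Properties using (toℕ-fromℕ; toℕ-inject₁; toℕ-fromℕ<; toℕ<n)
open import Data.Vec as Vec using (Vec; _∷_; _∷ʳ_)
open import Data.Rational as ℚ using (ℚ; 0ℚ; 1ℚ; ½; _+_; _*_; -_; _-_; toℚᵘ)
open import Data.Rational.Properties
import Data.Rational.Unnormalised as ℚᵘ
import Data.Rational.Unnormalised.Properties as ℚᵘP
open import Data.Rational.Solver using (module +-*-Solver)
open import Data.Bool using (Bool; true; false; not; if_then_else_)
open import Data.Bool.Properties using (not-involutive)
open import Data.List as List using (List; []; _∷_; _++_; [_]; length; lookup; removeAt; map; concatMap; reverse; applyUpTo; upTo; take; drop; tabulate)
open import Data.List.Properties using (++-assoc; ++-identityʳ; map-++; map-∘; map-cong; map-upTo; map-concatMap; map-tabulate; concatMap-cong; length-++; length-map; length-take; length-tabulate; length-upTo; take++drop≡id; unfold-reverse)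
open import Data.List.Membership.Propositional using (_∈_)
open import Data.List.Membership.Propositional.Properties using (∈-∃++; ∈-++⁺ˡ; ∈-++⁺ʳ; ∈-lookup; ∈-map⁺)
open import Data.List.Relation.Unary.Any using (here; there)
open import Data.List.Relation.Unary.All as All using (All; []; _∷_)
import Data.List.Relation.Unary.All.Properties as AllP
open import Data.List.Relation.Binary.Permutation.Propositional as ↭ using (_↭_; ↭-refl; ↭-trans; ↭-reflexive)
import Data.List.Relation.Binary.Permutation.Propositional.Properties as ↭P
open import Data.Sum using (_⊎_; inj₁; inj₂)
open import Data.Product using (Σ; _×_; _,_; proj₁; proj₂)
open import Function using (_∘′_; id)
open import Relation.Binary.PropositionalEquality hiding ([_])
open import Algebra.Apartness.Properties.HeytingCommutativeRing heytingCommutativeRing using (x#0y#0→xy#0)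
open +-*-Solver
open import Data.Nat.Tactic.RingSolver using (solve-∀)

private
  ℕtoℚ≃ : ∀ k → toℚᵘ (ℕtoℚ k) ℚᵘ.≃ ℚᵘ.mkℚᵘ (ℤ.+ k) 0
  ℕtoℚ≃ k = toℚᵘ-fromℚᵘ (ℚᵘ.mkℚᵘ (ℤ.+ k) 0)

ℕtoℚ-+ : ∀ m n → ℕtoℚ (m ℕ.+ n) ≡ ℕtoℚ m + ℕtoℚ n
ℕtoℚ-+ m n = toℚᵘ-injective (ℚᵘP.≃-trans (ℕtoℚ≃ (m ℕ.+ n)) (ℚᵘP.≃-trans homo
  (ℚᵘP.≃-sym (ℚᵘP.≃-trans (toℚᵘ-homo-+ (ℕtoℚ m) (ℕtoℚ n)) (ℚᵘP.+-cong (ℕtoℚ≃ m) (ℕtoℚ≃ n))))))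
  where
  homo : ℚᵘ.mkℚᵘ (ℤ.+ (m ℕ.+ n)) 0 ℚᵘ.≃ (ℚᵘ.mkℚᵘ (ℤ.+ m) 0 ℚᵘ.+ ℚᵘ.mkℚᵘ (ℤ.+ n) 0)
  homo = ℚᵘ.*≡* (cong (ℤ._* ℤ.+ 1) (trans (ℤP.pos-+ m n)
    (sym (cong₂ ℤ._+_ (ℤP.*-identityʳ (ℤ.+ m)) (ℤP.*-identityʳ (ℤ.+ n))))))

ℕtoℚ-*-invℕ : ∀ n → ℕtoℚ (suc n) * invℕ (suc n) ≡ 1ℚ
ℕtoℚ-*-invℕ n = toℚᵘ-injective (ℚᵘP.≃-trans (toℚᵘ-homo-* (ℕtoℚ (suc n)) (invℕ (suc n)))
  (ℚᵘP.≃-trans (ℚᵘP.*-cong (ℕtoℚ≃ (suc n)) (toℚᵘ-fromℚᵘ (ℚᵘ.mkℚᵘ (ℤ.+ 1) n))) (ℚᵘ.*≡* cross)))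
  where
  cross : (ℤ.+ suc n ℤ.* ℤ.+ 1) ℤ.* ℤ.+ 1 ≡ ℤ.+ 1 ℤ.* (ℤ.+ (1 ℕ.* suc n))
  cross = trans (ℤP.*-identityʳ _) (trans (ℤP.*-identityʳ _)
    (sym (trans (ℤP.*-identityˡ _) (cong ℤ.+_ (ℕP.*-identityˡ (suc n))))))

inverse⇒≢0 : ∀ {a b} → a * b ≡ 1ℚ → a ≢ 0ℚ
inverse⇒≢0 {a} {b} ab≡1 a≡0 = 1≢0 (trans (sym ab≡1) (trans (cong (_* b) a≡0) (*-zeroˡ b)))

^ℚ-distrib-* : ∀ a b n → (a ^ℚ n) * (b ^ℚ n) ≡ (a * b) ^ℚ n
^ℚ-distrib-* a b zero = refl
^ℚ-distrib-* a b (suc n) =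
  trans (solve 4 (λ a b x y → (a :* x) :* (b :* y) := (a :* b) :* (x :* y)) refl a b (a ^ℚ n) (b ^ℚ n))
    (cong ((a * b) *_) (^ℚ-distrib-* a b n))

1^ℚn≡1 : ∀ n → 1ℚ ^ℚ n ≡ 1ℚ
1^ℚn≡1 zero = refl
1^ℚn≡1 (suc n) = trans (*-identityˡ _) (1^ℚn≡1 n)

^ℚ-inverse : ∀ {a b} → a * b ≡ 1ℚ → ∀ n → (a ^ℚ n) * (b ^ℚ n) ≡ 1ℚ
^ℚ-inverse {a} {b} ab≡1 n = trans (^ℚ-distrib-* a b n) (trans (cong (_^ℚ n) ab≡1) (1^ℚn≡1 n))

y≡b*x⇒x≡a*y : ∀ {a b x y} → a * b ≡ 1ℚ → y ≡ b * x → x ≡ a * y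
y≡b*x⇒x≡a*y {a} {b} {x} {y} ab≡1 y≡bx = begin
  x            ≡⟨ sym (*-identityˡ x) ⟩
  1ℚ * x       ≡⟨ cong (_* x) (sym ab≡1) ⟩
  a * b * x    ≡⟨ *-assoc a b x ⟩
  a * (b * x)  ≡⟨ cong (a *_) (sym y≡bx) ⟩
  a * y        ∎
  where open ≡-Reasoning

ℕtoℚ-suc-cancelˡ : ∀ n x → ℕtoℚ (suc n) * x ≡ 0ℚ → x ≡ 0ℚ
ℕtoℚ-suc-cancelˡ n x eq =
  trans (y≡b*x⇒x≡a*y {invℕ (suc n)} {ℕtoℚ (suc n)} (trans (*-comm (invℕ (suc n)) _) (ℕtoℚ-*-invℕ n)) (sym eq))
    (*-zeroʳ (invℕ (suc n)))

x≡-x⇒x≡0 : ∀ {x} → x ≡ - x → x ≡ 0ℚ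
x≡-x⇒x≡0 {x} e = begin
  x             ≡⟨ solve 1 (λ x → x := con ½ :* (x :+ x)) refl x ⟩
  ½ * (x + x)   ≡⟨ cong (λ z → ½ * (x + z)) e ⟩
  ½ * (x - x)   ≡⟨ cong (½ *_) (+-inverseʳ x) ⟩
  0ℚ            ∎
  where open ≡-Reasoning

sgn-square : ∀ k → sgn k * sgn k ≡ 1ℚ
sgn-square zero = refl
sgn-square (suc k) = trans (solve 1 (λ s → (:- s) :* (:- s) := s :* s) refl (sgn k)) (sgn-square k)

sgn-≢0 : ∀ n → sgn n ≢ 0ℚ
sgn-≢0 n = inverse⇒≢0 (sgn-square n)

sgn-even : ∀ n → isEven n ≡ true → sgn n ≡ 1ℚ
sgn-even zero _ = refl
sgn-even (suc (suc n)) e = trans (solve 1 (λ s → :- (:- s) := s) refl (sgn n)) (sgn-even n e)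

sgn-odd : ∀ n → isEven n ≡ false → sgn n ≡ - 1ℚ
sgn-odd (suc zero) _ = refl
sgn-odd (suc (suc n)) e = trans (solve 1 (λ s → :- (:- s) := s) refl (sgn n)) (sgn-odd n e)

sumFin-cong : ∀ m {f g : Fin m → ℚ} → (∀ j → f j ≡ g j) → sumFin m f ≡ sumFin m g
sumFin-cong zero h = refl
sumFin-cong (suc m) h = cong₂ _+_ (h Fin.zero) (sumFin-cong m (λ j → h (Fin.suc j)))

sumFin-neg : ∀ m (f : Fin m → ℚ) → sumFin m (λ j → - f j) ≡ - sumFin m f
sumFin-neg zero f = refl
sumFin-neg (suc m) f = trans (cong (- f Fin.zero +_) (sumFin-neg m (λ j → f (Fin.suc j))))
  (sym (neg-distrib-+ (f Fin.zero) _))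

sumFin-linear : ∀ m (a c : ℚ) (f g : Fin m → ℚ) →
                sumFin m (λ j → a * f j + c * g j) ≡ a * sumFin m f + c * sumFin m g
sumFin-linear zero a c f g = solve 2 (λ a c → con 0ℚ := a :* con 0ℚ :+ c :* con 0ℚ) refl a c
sumFin-linear (suc m) a c f g =
  trans (cong ((a * f Fin.zero + c * g Fin.zero) +_) (sumFin-linear m a c (λ j → f (Fin.suc j)) (λ j → g (Fin.suc j))))
    (solve 6 (λ a c x y s t → (a :* x :+ c :* y) :+ (a :* s :+ c :* t) := a :* (x :+ s) :+ c :* (y :+ t)) refl
       a c (f Fin.zero) (g Fin.zero) (sumFin m (λ j → f (Fin.suc j))) (sumFin m (λ j → g (Fin.suc j))))

sumFin-zero : ∀ m (f : Fin m → ℚ) → (∀ j → f j ≡ 0ℚ) → sumFin m f ≡ 0ℚ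
sumFin-zero zero f h = refl
sumFin-zero (suc m) f h = trans (cong₂ _+_ (h Fin.zero) (sumFin-zero m (λ j → f (Fin.suc j)) (λ j → h (Fin.suc j)))) refl

Seq : Set
Seq = ℕ → ℚ

sumTo : ℕ → Seq → ℚ
sumTo n f = sumFin n (λ j → f (toℕ j))

sumTo-cong : ∀ n {f g : Seq} → (∀ k → k < n → f k ≡ g k) → sumTo n f ≡ sumTo n g
sumTo-cong zero h = refl
sumTo-cong (suc n) h = cong₂ _+_ (h 0 (s≤s z≤n)) (sumTo-cong n (λ k k<n → h (suc k) (s≤s k<n)))

sumTo-+ : ∀ n (f g : Seq) → sumTo n (λ k → f k + g k) ≡ sumTo n f + sumTo n g
sumTo-+ zero f g = refl
sumTo-+ (suc n) f g = trans (cong ((f 0 + g 0) +_) (sumTo-+ n (f ∘′ suc) (g ∘′ suc)))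
  (solve 4 (λ a b c d → (a :+ b) :+ (c :+ d) := (a :+ c) :+ (b :+ d)) refl
    (f 0) (g 0) (sumTo n (f ∘′ suc)) (sumTo n (g ∘′ suc)))

sumTo-last : ∀ n (f : Seq) → sumTo (suc n) f ≡ sumTo n f + f n
sumTo-last zero f = trans (+-identityʳ (f 0)) (sym (+-identityˡ (f 0)))
sumTo-last (suc n) f = trans (cong (f 0 +_) (sumTo-last n (λ k → f (suc k)))) (sym (+-assoc (f 0) _ _))

sumTo-zero : ∀ n (f : Seq) → (∀ k → k < n → f k ≡ 0ℚ) → sumTo n f ≡ 0ℚ
sumTo-zero zero f h = refl
sumTo-zero (suc n) f h = trans (cong₂ _+_ (h 0 (s≤s z≤n)) (sumTo-zero n (λ k → f (suc k)) (λ k k<n → h (suc k) (s≤s k<n))))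
  (+-identityˡ 0ℚ)

shift : Seq → Seq
shift u n = u (suc n)

-- Exponential convolution, i.e. the product of exponential generating functions. It is defined
-- by the Leibniz rule (u ⋆ w)′ = u′ ⋆ w + u ⋆ w′, which makes every algebraic law a short
-- induction; ⋆-binomial recovers the usual formula.
infixl 7 _⋆_
_⋆_ : Seq → Seq → Seq
(u ⋆ w) zero = u 0 * w 0
(u ⋆ w) (suc n) = (shift u ⋆ w) n + (u ⋆ shift w) n

⋆-congˡ : ∀ {u u'} w → (∀ k → u k ≡ u' k) → ∀ n → (u ⋆ w) n ≡ (u' ⋆ w) n
⋆-congˡ w h zero = cong (_* w 0) (h 0)
⋆-congˡ w h (suc n) = cong₂ _+_ (⋆-congˡ w (λ k → h (suc k)) n) (⋆-congˡ (shift w) h n)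

⋆-congʳ : ∀ u {w w'} → (∀ k → w k ≡ w' k) → ∀ n → (u ⋆ w) n ≡ (u ⋆ w') n
⋆-congʳ u h zero = cong (u 0 *_) (h 0)
⋆-congʳ u h (suc n) = cong₂ _+_ (⋆-congʳ (shift u) h n) (⋆-congʳ u (λ k → h (suc k)) n)

private
  interchange : ∀ a b c d → (a + b) + (c + d) ≡ (a + c) + (b + d)
  interchange = solve 4 (λ a b c d → (a :+ b) :+ (c :+ d) := (a :+ c) :+ (b :+ d)) refl

⋆-distribʳ-+ : ∀ u u' w n → ((λ k → u k + u' k) ⋆ w) n ≡ (u ⋆ w) n + (u' ⋆ w) n
⋆-distribʳ-+ u u' w zero = *-distribʳ-+ (w 0) (u 0) (u' 0)
⋆-distribʳ-+ u u' w (suc n) = trans (cong₂ _+_ (⋆-distribʳ-+ (shift u) (shift u') w n) (⋆-distribʳ-+ u u' (shift w) n))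
  (interchange ((shift u ⋆ w) n) ((shift u' ⋆ w) n) ((u ⋆ shift w) n) ((u' ⋆ shift w) n))

⋆-distribˡ-+ : ∀ u w w' n → (u ⋆ (λ k → w k + w' k)) n ≡ (u ⋆ w) n + (u ⋆ w') n
⋆-distribˡ-+ u w w' zero = *-distribˡ-+ (u 0) (w 0) (w' 0)
⋆-distribˡ-+ u w w' (suc n) = trans (cong₂ _+_ (⋆-distribˡ-+ (shift u) w w' n) (⋆-distribˡ-+ u (shift w) (shift w') n))
  (interchange ((shift u ⋆ w) n) ((shift u ⋆ w') n) ((u ⋆ shift w) n) ((u ⋆ shift w') n))

⋆-scaleˡ : ∀ a u w n → ((λ k → a * u k) ⋆ w) n ≡ a * (u ⋆ w) n
⋆-scaleˡ a u w zero = *-assoc a (u 0) (w 0)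
⋆-scaleˡ a u w (suc n) = trans (cong₂ _+_ (⋆-scaleˡ a (shift u) w n) (⋆-scaleˡ a u (shift w) n))
  (sym (*-distribˡ-+ a _ _))

⋆-scaleʳ : ∀ a u w n → (u ⋆ (λ k → a * w k)) n ≡ a * (u ⋆ w) n
⋆-scaleʳ a u w zero = solve 3 (λ a x y → x :* (a :* y) := a :* (x :* y)) refl a (u 0) (w 0)
⋆-scaleʳ a u w (suc n) = trans (cong₂ _+_ (⋆-scaleʳ a (shift u) w n) (⋆-scaleʳ a u (shift w) n))
  (sym (*-distribˡ-+ a _ _))

⋆-negˡ : ∀ u w n → ((λ k → - u k) ⋆ w) n ≡ - (u ⋆ w) n
⋆-negˡ u w zero = sym (neg-distribˡ-* (u 0) (w 0))
⋆-negˡ u w (suc n) = trans (cong₂ _+_ (⋆-negˡ (shift u) w n) (⋆-negˡ u (shift w) n))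
  (sym (neg-distrib-+ ((shift u ⋆ w) n) ((u ⋆ shift w) n)))

⋆-negʳ : ∀ u w n → (u ⋆ (λ k → - w k)) n ≡ - (u ⋆ w) n
⋆-negʳ u w zero = sym (neg-distribʳ-* (u 0) (w 0))
⋆-negʳ u w (suc n) = trans (cong₂ _+_ (⋆-negʳ (shift u) w n) (⋆-negʳ u (shift w) n))
  (sym (neg-distrib-+ ((shift u ⋆ w) n) ((u ⋆ shift w) n)))

⋆-assoc : ∀ u v w n → ((u ⋆ v) ⋆ w) n ≡ (u ⋆ (v ⋆ w)) n
⋆-assoc u v w zero = *-assoc (u 0) (v 0) (w 0)
⋆-assoc u v w (suc n) = begin
  (shift (u ⋆ v) ⋆ w) n + ((u ⋆ v) ⋆ shift w) n
    ≡⟨ cong (_+ ((u ⋆ v) ⋆ shift w) n) (⋆-distribʳ-+ (shift u ⋆ v) (u ⋆ shift v) w n) ⟩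
  (((shift u ⋆ v) ⋆ w) n + ((u ⋆ shift v) ⋆ w) n) + ((u ⋆ v) ⋆ shift w) n
    ≡⟨ cong₂ _+_ (cong₂ _+_ (⋆-assoc (shift u) v w n) (⋆-assoc u (shift v) w n)) (⋆-assoc u v (shift w) n) ⟩
  ((shift u ⋆ (v ⋆ w)) n + (u ⋆ (shift v ⋆ w)) n) + (u ⋆ (v ⋆ shift w)) n
    ≡⟨ +-assoc ((shift u ⋆ (v ⋆ w)) n) ((u ⋆ (shift v ⋆ w)) n) ((u ⋆ (v ⋆ shift w)) n) ⟩
  (shift u ⋆ (v ⋆ w)) n + ((u ⋆ (shift v ⋆ w)) n + (u ⋆ (v ⋆ shift w)) n)
    ≡⟨ cong ((shift u ⋆ (v ⋆ w)) n +_) (sym (⋆-distribˡ-+ u (shift v ⋆ w) (v ⋆ shift w) n)) ⟩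
  (shift u ⋆ (v ⋆ w)) n + (u ⋆ shift (v ⋆ w)) n ∎
  where open ≡-Reasoning

δ₀ δ₁ : Seq
δ₀ zero = 1ℚ
δ₀ (suc _) = 0ℚ
δ₁ 1 = 1ℚ
δ₁ _ = 0ℚ

⋆-zeroʳ : ∀ u n → (u ⋆ (λ _ → 0ℚ)) n ≡ 0ℚ
⋆-zeroʳ u zero = *-zeroʳ (u 0)
⋆-zeroʳ u (suc n) = trans (cong₂ _+_ (⋆-zeroʳ (shift u) n) (⋆-zeroʳ u n)) (+-identityˡ 0ℚ)

⋆-identityʳ : ∀ u n → (u ⋆ δ₀) n ≡ u n
⋆-identityʳ u zero = *-identityʳ (u 0)
⋆-identityʳ u (suc n) = trans (cong₂ _+_ (⋆-identityʳ (shift u) n) (⋆-zeroʳ u n)) (+-identityʳ _)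

-- With exponential generating functions: ones = e^z, sgn = e^(-z), powers x = e^(xz),
-- and twist u is u(-z).

ones : Seq
ones _ = 1ℚ

ones⋆sgn : ∀ n → (ones ⋆ sgn) n ≡ δ₀ n
ones⋆sgn zero = refl
ones⋆sgn (suc n) = trans (cong ((ones ⋆ sgn) n +_) (⋆-negʳ ones sgn n)) (+-inverseʳ ((ones ⋆ sgn) n))

twist : Seq → Seq
twist u k = sgn k * u k

twist-⋆ : ∀ u w n → (twist u ⋆ twist w) n ≡ sgn n * (u ⋆ w) n
twist-⋆ u w zero = solve 2 (λ a b → (con 1ℚ :* a) :* (con 1ℚ :* b) := con 1ℚ :* (a :* b)) refl (u 0) (w 0)
twist-⋆ u w (suc n) = begin
  (shift (twist u) ⋆ twist w) n + (twist u ⋆ shift (twist w)) n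
    ≡⟨ cong₂ _+_ (⋆-congˡ (twist w) (λ k → sym (neg-distribˡ-* (sgn k) (u (suc k)))) n)
                 (⋆-congʳ (twist u) (λ k → sym (neg-distribˡ-* (sgn k) (w (suc k)))) n) ⟩
  ((λ k → - twist (shift u) k) ⋆ twist w) n + (twist u ⋆ (λ k → - twist (shift w) k)) n
    ≡⟨ cong₂ _+_ (⋆-negˡ (twist (shift u)) (twist w) n) (⋆-negʳ (twist u) (twist (shift w)) n) ⟩
  - (twist (shift u) ⋆ twist w) n + - (twist u ⋆ twist (shift w)) n
    ≡⟨ cong₂ (λ a b → - a + - b) (twist-⋆ (shift u) w n) (twist-⋆ u (shift w) n) ⟩
  - (sgn n * (shift u ⋆ w) n) + - (sgn n * (u ⋆ shift w) n)
    ≡⟨ solve 3 (λ s a b → (:- (s :* a)) :+ (:- (s :* b)) := (:- s) :* (a :+ b)) refl (sgn n) _ _ ⟩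
  - sgn n * ((shift u ⋆ w) n + (u ⋆ shift w) n) ∎
  where open ≡-Reasoning

powers : ℚ → Seq
powers a k = a ^ℚ k

powers-⋆ : ∀ a c n → (powers a ⋆ powers c) n ≡ (a + c) ^ℚ n
powers-⋆ a c zero = refl
powers-⋆ a c (suc n) = trans (cong₂ _+_ (⋆-scaleˡ a (powers a) (powers c) n) (⋆-scaleʳ c (powers a) (powers c) n))
  (trans (cong₂ (λ x y → a * x + c * y) (powers-⋆ a c n) (powers-⋆ a c n))
    (sym (*-distribʳ-+ ((a + c) ^ℚ n) a c)))

powers-neg : ∀ x k → powers (- x) k ≡ twist (powers x) k
powers-neg x zero = refl
powers-neg x (suc k) = trans (cong (- x *_) (powers-neg x k))
  (solve 3 (λ x s p → (:- x) :* (s :* p) := (:- s) :* (x :* p)) refl x (sgn k) (powers x k))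

binomial : ℕ → ℕ → ℚ
binomial n k = ℕtoℚ (n C k)

pascal : ∀ n k → binomial (suc n) (suc k) ≡ binomial n k + binomial n (suc k)
pascal n k = trans (cong ℕtoℚ (sym (nCk+nC[k+1]≡[n+1]C[k+1] n k))) (ℕtoℚ-+ (n C k) (n C suc k))

⋆-binomial : ∀ n u w → (u ⋆ w) n ≡ sumTo (suc n) (λ j → binomial n j * u j * w (n ∸ j))
⋆-binomial zero u w = solve 2 (λ a b → a :* b := (con 1ℚ :* a :* b) :+ con 0ℚ) refl (u 0) (w 0)
⋆-binomial (suc n) u w = begin
  (shift u ⋆ w) n + (u ⋆ shift w) n
    ≡⟨ cong₂ _+_ (⋆-binomial n (shift u) w) (trans (⋆-binomial n u (shift w)) (sumTo-cong (suc n) λ j j≤n →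
          cong (λ i → binomial n j * u j * w i) (sym (ℕP.+-∸-assoc 1 (ℕP.≤-pred j≤n))))) ⟩
  A + (first + rest)
    ≡⟨ solve 3 (λ a g p → a :+ (g :+ p) := g :+ (a :+ (p :+ con 0ℚ))) refl A first rest ⟩
  first + (A + (rest + 0ℚ))
    ≡⟨ cong (λ z → first + (A + z)) (sym (trans (sumTo-last n Q) (cong (rest +_) Q-last))) ⟩
  first + (A + sumTo (suc n) Q)
    ≡⟨ cong (first +_) (sym (sumTo-+ (suc n) P Q)) ⟩
  first + sumTo (suc n) (λ k → P k + Q k)
    ≡⟨ cong (first +_) (sumTo-cong (suc n) λ k _ → trans
          (solve 4 (λ a b x y → a :* x :* y :+ b :* x :* y := (a :+ b) :* x :* y) refl
                 (binomial n k) (binomial n (suc k)) (u (suc k)) (w (n ∸ k)))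
          (cong (λ z → z * u (suc k) * w (n ∸ k)) (sym (pascal n k)))) ⟩
  first + sumTo (suc n) (λ k → binomial (suc n) (suc k) * u (suc k) * w (n ∸ k)) ∎
  where
  open ≡-Reasoning
  P Q : Seq
  P j = binomial n j * u (suc j) * w (n ∸ j)
  Q k = binomial n (suc k) * u (suc k) * w (n ∸ k)
  A first rest : ℚ
  A = sumTo (suc n) P
  first = binomial n 0 * u 0 * w (suc n)
  rest = sumTo n Q
  Q-last : Q n ≡ 0ℚ
  Q-last = trans (cong (λ z → ℕtoℚ z * u (suc n) * w (n ∸ n)) (k>n⇒nCk≡0 (ℕP.n<1+n n)))
    (solve 2 (λ x y → con 0ℚ :* x :* y := con 0ℚ) refl (u (suc n)) (w (n ∸ n)))

-- Bernoulli numbers and polynomials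

private
  lookup-∷ʳ-inject₁ : ∀ {A : Set} {n} (v : Vec A n) x (i : Fin n) → Vec.lookup (v ∷ʳ x) (Fin.inject₁ i) ≡ Vec.lookup v i
  lookup-∷ʳ-inject₁ (y ∷ v) x Fin.zero = refl
  lookup-∷ʳ-inject₁ (y ∷ v) x (Fin.suc i) = lookup-∷ʳ-inject₁ v x i

  lookup-∷ʳ-last : ∀ {A : Set} {n} (v : Vec A n) x → Vec.lookup (v ∷ʳ x) (Fin.fromℕ n) ≡ x
  lookup-∷ʳ-last Vec.[] x = refl
  lookup-∷ʳ-last (y ∷ v) x = lookup-∷ʳ-last v x

  fromℕ⊎inject₁ : ∀ {n} (j : Fin (suc n)) → (j ≡ Fin.fromℕ n) ⊎ Σ (Fin n) (λ j' → j ≡ Fin.inject₁ j')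
  fromℕ⊎inject₁ {zero} Fin.zero = inj₁ refl
  fromℕ⊎inject₁ {suc n} Fin.zero = inj₂ (Fin.zero , refl)
  fromℕ⊎inject₁ {suc n} (Fin.suc j) with fromℕ⊎inject₁ j
  ... | inj₁ eq = inj₁ (cong Fin.suc eq)
  ... | inj₂ (j' , eq) = inj₂ (Fin.suc j' , cong Fin.suc eq)

lookup-bernVec : ∀ n (j : Fin (suc n)) → Vec.lookup (bernVec n) j ≡ bern (toℕ j)
lookup-bernVec zero Fin.zero = refl
lookup-bernVec (suc n) j with fromℕ⊎inject₁ j
... | inj₁ refl = cong bern (sym (toℕ-fromℕ (suc n)))
... | inj₂ (j' , refl) = trans (lookup-∷ʳ-inject₁ (bernVec n) _ j')
        (trans (lookup-bernVec n j') (cong bern (sym (toℕ-inject₁ j'))))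

bern-suc : ∀ n → bern (suc n) ≡ - (invℕ (suc (suc n)) * sumTo (suc n) (λ j → binomial (suc (suc n)) j * bern j))
bern-suc n = trans (lookup-∷ʳ-last (bernVec n) _)
  (cong (λ z → - (invℕ (suc (suc n)) * z))
    (sumFin-cong (suc n) (λ j → cong (binomial (suc (suc n)) (toℕ j) *_) (lookup-bernVec n j))))

binomial-pred : ∀ n → binomial (suc n) n ≡ ℕtoℚ (suc n)
binomial-pred n = cong ℕtoℚ (trans (nCk≡nC[n∸k] (ℕP.n≤1+n n))
  (trans (cong (suc n C_) (ℕP.m+n∸n≡m 1 n)) (nC1≡n (suc n))))

binomial-diag : ∀ n x → binomial n n * x ≡ x
binomial-diag n x = trans (cong (λ c → ℕtoℚ c * x) (nCn≡1 n)) (*-identityˡ x)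

bern-recurrence : ∀ n → sumTo (suc (suc n)) (λ j → binomial (suc (suc n)) j * bern j) ≡ 0ℚ
bern-recurrence n = begin
  sumTo (suc (suc n)) f                 ≡⟨ sumTo-last (suc n) f ⟩
  S + binomial (2 ℕ.+ n) (suc n) * bern (suc n)
    ≡⟨ cong₂ (λ p q → S + p * q) (binomial-pred (suc n)) (bern-suc n) ⟩
  S + a * (- (invℕ (2 ℕ.+ n) * S))
    ≡⟨ solve 3 (λ s a i → s :+ a :* (:- (i :* s)) := s :- (a :* i) :* s) refl S a (invℕ (2 ℕ.+ n)) ⟩
  S - (a * invℕ (2 ℕ.+ n)) * S          ≡⟨ cong (λ z → S - z * S) (ℕtoℚ-*-invℕ (suc n)) ⟩
  S - 1ℚ * S                            ≡⟨ cong (λ z → S - z) (*-identityˡ S) ⟩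
  S - S                                 ≡⟨ +-inverseʳ S ⟩
  0ℚ                                    ∎
  where
  open ≡-Reasoning
  f : Seq
  f j = binomial (suc (suc n)) j * bern j
  S a : ℚ
  S = sumTo (suc n) f
  a = ℕtoℚ (2 ℕ.+ n)

-- The defining recurrence of the Bernoulli numbers, read as B(z) eᶻ = B(z) + z.
bern⋆ones : ∀ n → (bern ⋆ ones) n ≡ bern n + δ₁ n
bern⋆ones zero = refl
bern⋆ones (suc zero) = refl
bern⋆ones (suc (suc n)) = begin
  (bern ⋆ ones) (2 ℕ.+ n)                                  ≡⟨ ⋆-binomial (2 ℕ.+ n) bern ones ⟩
  sumTo (3 ℕ.+ n) g                                        ≡⟨ sumTo-last (2 ℕ.+ n) g ⟩
  sumTo (2 ℕ.+ n) g + g (2 ℕ.+ n)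
    ≡⟨ cong₂ _+_ (trans (sumTo-cong (2 ℕ.+ n) (λ j _ → *-identityʳ (f j))) (bern-recurrence n))
                 (trans (*-identityʳ (f (2 ℕ.+ n))) (binomial-diag (2 ℕ.+ n) (bern (2 ℕ.+ n)))) ⟩
  0ℚ + bern (2 ℕ.+ n)                                       ≡⟨ +-comm 0ℚ (bern (2 ℕ.+ n)) ⟩
  bern (2 ℕ.+ n) + 0ℚ                                       ∎
  where
  open ≡-Reasoning
  f g : Seq
  f j = binomial (2 ℕ.+ n) j * bern j
  g j = f j * ones (2 ℕ.+ n ∸ j)

-- The coefficient of index n + 2 of z ⋆ ones - z is (n + 2) z (n + 1) plus a combination of
-- lower coefficients of z.
⋆ones-fixed⇒≡0 : ∀ (z : Seq) → (∀ n → (z ⋆ ones) n ≡ z n) → z 0 ≡ 0ℚ → ∀ n → z n ≡ 0ℚ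
⋆ones-fixed⇒≡0 z fixed z0 n = below n n ℕP.≤-refl
  where
  below : ∀ m j → j ≤ m → z j ≡ 0ℚ
  below zero zero _ = z0
  below (suc m) j j≤ with ℕP.m≤n⇒m<n∨m≡n j≤
  ... | inj₁ j<1+m = below m j (ℕP.≤-pred j<1+m)
  ... | inj₂ refl = ℕtoℚ-suc-cancelˡ (suc m) (z (suc m)) leading
    where
    open ≡-Reasoning
    g : Seq
    g j = binomial (2 ℕ.+ m) j * z j * ones (2 ℕ.+ m ∸ j)
    lower : sumTo (suc m) g ≡ 0ℚ
    lower = sumTo-zero (suc m) g λ k k≤m → trans (cong (λ q → binomial (2 ℕ.+ m) k * q * 1ℚ) (below m k (ℕP.≤-pred k≤m)))
      (solve 1 (λ c → c :* con 0ℚ :* con 1ℚ := con 0ℚ) refl (binomial (2 ℕ.+ m) k))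
    expand : g (suc m) + z (2 ℕ.+ m) ≡ z (2 ℕ.+ m)
    expand = begin
      g (suc m) + z (2 ℕ.+ m)                  ≡⟨ cong (_+ z (2 ℕ.+ m)) (sym (+-identityˡ (g (suc m)))) ⟩
      0ℚ + g (suc m) + z (2 ℕ.+ m)
        ≡⟨ cong₂ (λ p q → p + g (suc m) + q) (sym lower) (sym (trans (*-identityʳ _) (binomial-diag (2 ℕ.+ m) _))) ⟩
      sumTo (suc m) g + g (suc m) + g (2 ℕ.+ m) ≡⟨ cong (_+ g (2 ℕ.+ m)) (sym (sumTo-last (suc m) g)) ⟩
      sumTo (2 ℕ.+ m) g + g (2 ℕ.+ m)           ≡⟨ sym (sumTo-last (2 ℕ.+ m) g) ⟩
      sumTo (3 ℕ.+ m) g                         ≡⟨ sym (⋆-binomial (2 ℕ.+ m) z ones) ⟩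
      (z ⋆ ones) (2 ℕ.+ m)                      ≡⟨ fixed (2 ℕ.+ m) ⟩
      z (2 ℕ.+ m)                               ∎
    leading : ℕtoℚ (2 ℕ.+ m) * z (suc m) ≡ 0ℚ
    leading = begin
      ℕtoℚ (2 ℕ.+ m) * z (suc m)               ≡⟨ cong (_* z (suc m)) (sym (binomial-pred (suc m))) ⟩
      binomial (2 ℕ.+ m) (suc m) * z (suc m)   ≡⟨ solve 2 (λ a q → a := (a :* con 1ℚ :+ q) :- q) refl _ (z (2 ℕ.+ m)) ⟩
      (g (suc m) + z (2 ℕ.+ m)) - z (2 ℕ.+ m)  ≡⟨ cong (_- z (2 ℕ.+ m)) expand ⟩
      z (2 ℕ.+ m) - z (2 ℕ.+ m)                ≡⟨ +-inverseʳ (z (2 ℕ.+ m)) ⟩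
      0ℚ                                       ∎

-- B(-z) = B(z) + z: both bern and d = twist bern - δ₁ solve u ⋆ ones = u + δ₁, whose solutions
-- are unique by ⋆ones-fixed⇒≡0.
twist-bern : ∀ n → twist bern n ≡ bern n + δ₁ n
twist-bern n = trans (solve 2 (λ t q → t := (t :- q) :+ q) refl (twist bern n) (δ₁ n))
  (cong (_+ δ₁ n) (trans (solve 2 (λ d b → d := (d :- b) :+ b) refl (d n) (bern n))
    (trans (cong (_+ bern n) (⋆ones-fixed⇒≡0 (λ k → d k - bern k) fixed refl n)) (+-identityˡ (bern n)))))
  where
  open ≡-Reasoning
  d : Seq
  d k = twist bern k - δ₁ k
  bern⋆ones⋆sgn : ∀ n → bern n ≡ ((λ k → bern k + δ₁ k) ⋆ sgn) n
  bern⋆ones⋆sgn n = begin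
    bern n                     ≡⟨ sym (⋆-identityʳ bern n) ⟩
    (bern ⋆ δ₀) n              ≡⟨ ⋆-congʳ bern (λ k → sym (ones⋆sgn k)) n ⟩
    (bern ⋆ (ones ⋆ sgn)) n    ≡⟨ sym (⋆-assoc bern ones sgn n) ⟩
    ((bern ⋆ ones) ⋆ sgn) n    ≡⟨ ⋆-congˡ sgn bern⋆ones n ⟩
    ((λ k → bern k + δ₁ k) ⋆ sgn) n ∎
  d-twist : ∀ k → twist (λ k → bern k + δ₁ k) k ≡ d k
  d-twist zero = *-distribˡ-+ 1ℚ (bern 0) 0ℚ
  d-twist (suc zero) = solve 1 (λ x → (:- con 1ℚ) :* (x :+ con 1ℚ) := (:- con 1ℚ) :* x :- con 1ℚ) refl (bern 1)
  d-twist (suc (suc k)) = solve 2 (λ s x → s :* (x :+ con 0ℚ) := s :* x :- con 0ℚ) refl (sgn (2 ℕ.+ k)) (bern (2 ℕ.+ k))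
  d⋆ones : ∀ n → (d ⋆ ones) n ≡ d n + δ₁ n
  d⋆ones n = begin
    (d ⋆ ones) n                                         ≡⟨ ⋆-congˡ ones (λ k → sym (d-twist k)) n ⟩
    (twist (λ k → bern k + δ₁ k) ⋆ ones) n               ≡⟨ ⋆-congʳ _ (λ k → sym (sgn-square k)) n ⟩
    (twist (λ k → bern k + δ₁ k) ⋆ twist sgn) n          ≡⟨ twist-⋆ (λ k → bern k + δ₁ k) sgn n ⟩
    sgn n * ((λ k → bern k + δ₁ k) ⋆ sgn) n              ≡⟨ cong (sgn n *_) (sym (bern⋆ones⋆sgn n)) ⟩
    twist bern n                                         ≡⟨ solve 2 (λ x y → x := (x :- y) :+ y) refl (twist bern n) (δ₁ n) ⟩
    d n + δ₁ n                                           ∎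
  fixed : ∀ n → ((λ k → d k - bern k) ⋆ ones) n ≡ d n - bern n
  fixed n = trans (⋆-distribʳ-+ d (λ k → - bern k) ones n) (trans (cong ((d ⋆ ones) n +_) (⋆-negˡ bern ones n))
    (trans (cong₂ (λ p q → p - q) (d⋆ones n) (bern⋆ones n))
      (solve 3 (λ x y q → (x :+ q) :- (y :+ q) := x :- y) refl (d n) (bern n) (δ₁ n))))

bernPoly≡bern⋆powers : ∀ n x → bernPoly n x ≡ (bern ⋆ powers x) n
bernPoly≡bern⋆powers n x = sym (⋆-binomial n bern (powers x))

bernPoly-reflect : ∀ n x y → x + y ≡ 1ℚ → bernPoly n y ≡ sgn n * bernPoly n x
bernPoly-reflect n x y x+y≡1 = begin
  bernPoly n y                        ≡⟨ bernPoly≡bern⋆powers n y ⟩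
  (bern ⋆ powers y) n                 ≡⟨ ⋆-congʳ bern powers-y n ⟩
  (bern ⋆ (ones ⋆ powers (- x))) n    ≡⟨ sym (⋆-assoc bern ones (powers (- x)) n) ⟩
  ((bern ⋆ ones) ⋆ powers (- x)) n    ≡⟨ ⋆-congˡ (powers (- x)) (λ k → trans (bern⋆ones k) (sym (twist-bern k))) n ⟩
  (twist bern ⋆ powers (- x)) n       ≡⟨ ⋆-congʳ (twist bern) (powers-neg x) n ⟩
  (twist bern ⋆ twist (powers x)) n   ≡⟨ twist-⋆ bern (powers x) n ⟩
  sgn n * (bern ⋆ powers x) n         ≡⟨ cong (sgn n *_) (sym (bernPoly≡bern⋆powers n x)) ⟩
  sgn n * bernPoly n x                ∎
  where
  open ≡-Reasoning
  y≡1-x : y ≡ 1ℚ - x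
  y≡1-x = trans (solve 2 (λ x y → y := (x :+ y) :- x) refl x y) (cong (_- x) x+y≡1)
  powers-y : ∀ k → powers y k ≡ (ones ⋆ powers (- x)) k
  powers-y k = trans (cong (λ z → powers z k) y≡1-x)
    (trans (sym (powers-⋆ 1ℚ (- x) k)) (⋆-congˡ (powers (- x)) 1^ℚn≡1 k))

bern-odd≡0 : ∀ n → isEven n ≡ false → 2 ≤ n → bern n ≡ 0ℚ
bern-odd≡0 (suc zero) _ (s≤s ())
bern-odd≡0 n@(suc (suc _)) odd _ = x≡-x⇒x≡0 (begin
  bern n              ≡⟨ solve 1 (λ b → b := :- ((:- con 1ℚ) :* b)) refl (bern n) ⟩
  - (- 1ℚ * bern n)   ≡⟨ cong (λ s → - (s * bern n)) (sym (sgn-odd n odd)) ⟩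
  - twist bern n      ≡⟨ cong -_ (twist-bern n) ⟩
  - (bern n + 0ℚ)     ≡⟨ cong -_ (+-identityʳ (bern n)) ⟩
  - bern n            ∎)
  where open ≡-Reasoning

bernTilde-reflect-even : ∀ D n x y → x + y ≡ 1ℚ → isEven n ≡ true → bernTilde D n y ≡ bernTilde D n x
bernTilde-reflect-even D n x y x+y≡1 even = cong (λ z → (ℕtoℚ D ^ℚ n) * (z - bern n))
  (trans (bernPoly-reflect n x y x+y≡1) (trans (cong (_* bernPoly n x) (sgn-even n even)) (*-identityˡ (bernPoly n x))))

bernTilde-reflect-odd : ∀ D n x y → x + y ≡ 1ℚ → isEven n ≡ false → 2 ≤ n → bernTilde D n y ≡ - bernTilde D n x
bernTilde-reflect-odd D n x y x+y≡1 odd 2≤n = begin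
  P * (bernPoly n y - bern n)     ≡⟨ cong₂ (λ p q → P * (p - q)) (trans (bernPoly-reflect n x y x+y≡1) (cong (_* bernPoly n x) (sgn-odd n odd))) Bₙ≡0 ⟩
  P * (- 1ℚ * bernPoly n x - 0ℚ)  ≡⟨ solve 2 (λ p q → p :* ((:- con 1ℚ) :* q :- con 0ℚ) := :- (p :* (q :- con 0ℚ))) refl P (bernPoly n x) ⟩
  - (P * (bernPoly n x - 0ℚ))     ≡⟨ cong (λ q → - (P * (bernPoly n x - q))) (sym Bₙ≡0) ⟩
  - (P * (bernPoly n x - bern n)) ∎
  where
  open ≡-Reasoning
  P : ℚ
  P = ℕtoℚ D ^ℚ n
  Bₙ≡0 : bern n ≡ 0ℚ
  Bₙ≡0 = bern-odd≡0 n odd 2≤n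

-- Column operations on detL

sgn-+ : ∀ m n → sgn (m ℕ.+ n) ≡ sgn m * sgn n
sgn-+ zero n = sym (*-identityˡ (sgn n))
sgn-+ (suc m) n = trans (cong -_ (sgn-+ m n)) (neg-distribˡ-* (sgn m) (sgn n))

swaps : ∀ {A : Set} {xs ys : List A} → xs ↭ ys → ℕ
swaps ↭.refl = 0
swaps (↭.prep _ p) = swaps p
swaps (↭.swap _ _ p) = suc (swaps p)
swaps (↭.trans p q) = swaps p ℕ.+ swaps q

module _ {R Col : Set} (f : R → Col → ℚ) where

  -- Expansion along the first row x, where every minor carries the columns pre in front:
  -- detL f (x ∷ xs) cs is expand x xs [] cs. The extra prefix is what lets the column lemmas
  -- below go through by induction on the rows.
  expand : R → List R → List Col → List Col → ℚ
  expand x xs pre cs = sumFin (length cs) (λ j → sgn (toℕ j) * f x (lookup cs j) * detL f xs (pre ++ removeAt cs j))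

  expand-∷ : ∀ x xs pre c cs → expand x xs pre (c ∷ cs) ≡ f x c * detL f xs (pre ++ cs) + - expand x xs (pre ++ [ c ]) cs
  expand-∷ x xs pre c cs = cong₂ _+_ (cong (_* detL f xs (pre ++ cs)) (*-identityˡ (f x c)))
    (trans (sumFin-cong (length cs) (λ j → trans
              (cong (λ l → (- sgn (toℕ j)) * f x (lookup cs j) * detL f xs l) (sym (++-assoc pre [ c ] (removeAt cs j))))
              (solve 3 (λ s a d → (:- s) :* a :* d := :- (s :* a :* d)) refl
                 (sgn (toℕ j)) (f x (lookup cs j)) (detL f xs ((pre ++ [ c ]) ++ removeAt cs j)))))
           (sumFin-neg (length cs) (λ j → sgn (toℕ j) * f x (lookup cs j) * detL f xs ((pre ++ [ c ]) ++ removeAt cs j))))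

  detL-[]-∷ : ∀ p c q → detL f [] (p ++ c ∷ q) ≡ 0ℚ
  detL-[]-∷ [] c q = refl
  detL-[]-∷ (x ∷ p) c q = refl

  private
    SwapAntisymmetric : List R → Set
    SwapAntisymmetric xs = ∀ p a b q → detL f xs (p ++ a ∷ b ∷ q) ≡ - detL f xs (p ++ b ∷ a ∷ q)

    expand-swap-pre : ∀ xs → SwapAntisymmetric xs → ∀ x P a b Q cs →
                      expand x xs (P ++ a ∷ b ∷ Q) cs ≡ - expand x xs (P ++ b ∷ a ∷ Q) cs
    expand-swap-pre xs ih x P a b Q cs =
      trans (sumFin-cong (length cs) (λ j → trans
              (cong (λ d → sgn (toℕ j) * f x (lookup cs j) * d)
                (trans (cong (detL f xs) (++-assoc P (a ∷ b ∷ Q) (removeAt cs j)))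
                  (trans (ih P a b (Q ++ removeAt cs j))
                    (cong (λ l → - detL f xs l) (sym (++-assoc P (b ∷ a ∷ Q) (removeAt cs j)))))))
              (solve 3 (λ s g d → s :* g :* (:- d) := :- (s :* g :* d)) refl
                 (sgn (toℕ j)) (f x (lookup cs j)) (detL f xs ((P ++ b ∷ a ∷ Q) ++ removeAt cs j)))))
        (sumFin-neg (length cs) (λ j → sgn (toℕ j) * f x (lookup cs j) * detL f xs ((P ++ b ∷ a ∷ Q) ++ removeAt cs j)))

    expand-swap : ∀ xs → SwapAntisymmetric xs → ∀ x pre p a b q →
                  expand x xs pre (p ++ a ∷ b ∷ q) ≡ - expand x xs pre (p ++ b ∷ a ∷ q)
    expand-swap xs ih x pre [] a b q = begin
      expand x xs pre (a ∷ b ∷ q)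
        ≡⟨ expand-∷ x xs pre a (b ∷ q) ⟩
      f x a * detL f xs (pre ++ b ∷ q) + - expand x xs (pre ++ [ a ]) (b ∷ q)
        ≡⟨ cong (λ z → f x a * detL f xs (pre ++ b ∷ q) + - z) (expand-∷ x xs (pre ++ [ a ]) b q) ⟩
      f x a * detL f xs (pre ++ b ∷ q) + - (f x b * detL f xs ((pre ++ [ a ]) ++ q) + - expand x xs ((pre ++ [ a ]) ++ [ b ]) q)
        ≡⟨ cong₂ (λ l E → f x a * detL f xs (pre ++ b ∷ q) + - (f x b * detL f xs l + - E))
             (++-assoc pre [ a ] q)
             (trans (cong (λ P → expand x xs P q) (++-assoc pre [ a ] [ b ]))
               (trans (expand-swap-pre xs ih x pre a b [] q) (cong (λ P → - expand x xs P q) (sym (++-assoc pre [ b ] [ a ]))))) ⟩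
      f x a * Db + - (f x b * Da + - (- Eba))
        ≡⟨ solve 5 (λ fa fb da db e → fa :* db :+ (:- (fb :* da :+ (:- (:- e)))) := :- (fb :* da :+ (:- (fa :* db :+ (:- e))))) refl
             (f x a) (f x b) Da Db Eba ⟩
      - (f x b * Da + - (f x a * Db + - Eba))
        ≡⟨ cong (λ l → - (f x b * Da + - (f x a * detL f xs l + - Eba))) (sym (++-assoc pre [ b ] q)) ⟩
      - (f x b * Da + - (f x a * detL f xs ((pre ++ [ b ]) ++ q) + - Eba))
        ≡⟨ cong (λ z → - (f x b * Da + - z)) (sym (expand-∷ x xs (pre ++ [ b ]) a q)) ⟩
      - (f x b * Da + - expand x xs (pre ++ [ b ]) (a ∷ q))
        ≡⟨ cong -_ (sym (expand-∷ x xs pre b (a ∷ q))) ⟩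
      - expand x xs pre (b ∷ a ∷ q) ∎
      where
      open ≡-Reasoning
      Da Db Eba : ℚ
      Da = detL f xs (pre ++ a ∷ q)
      Db = detL f xs (pre ++ b ∷ q)
      Eba = expand x xs ((pre ++ [ b ]) ++ [ a ]) q
    expand-swap xs ih x pre (c ∷ p) a b q = begin
      expand x xs pre (c ∷ (p ++ a ∷ b ∷ q))
        ≡⟨ expand-∷ x xs pre c (p ++ a ∷ b ∷ q) ⟩
      f x c * detL f xs (pre ++ p ++ a ∷ b ∷ q) + - expand x xs (pre ++ [ c ]) (p ++ a ∷ b ∷ q)
        ≡⟨ cong₂ (λ u v → f x c * u + - v)
             (trans (cong (detL f xs) (sym (++-assoc pre p (a ∷ b ∷ q))))
               (trans (ih (pre ++ p) a b q) (cong (λ l → - detL f xs l) (++-assoc pre p (b ∷ a ∷ q)))))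
             (expand-swap xs ih x (pre ++ [ c ]) p a b q) ⟩
      f x c * (- detL f xs (pre ++ p ++ b ∷ a ∷ q)) + - (- expand x xs (pre ++ [ c ]) (p ++ b ∷ a ∷ q))
        ≡⟨ solve 3 (λ g d e → g :* (:- d) :+ (:- (:- e)) := :- (g :* d :+ (:- e))) refl
             (f x c) (detL f xs (pre ++ p ++ b ∷ a ∷ q)) (expand x xs (pre ++ [ c ]) (p ++ b ∷ a ∷ q)) ⟩
      - (f x c * detL f xs (pre ++ p ++ b ∷ a ∷ q) + - expand x xs (pre ++ [ c ]) (p ++ b ∷ a ∷ q))
        ≡⟨ cong -_ (sym (expand-∷ x xs pre c (p ++ b ∷ a ∷ q))) ⟩
      - expand x xs pre (c ∷ (p ++ b ∷ a ∷ q)) ∎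
      where open ≡-Reasoning

  detL-swap : ∀ xs p a b q → detL f xs (p ++ a ∷ b ∷ q) ≡ - detL f xs (p ++ b ∷ a ∷ q)
  detL-swap [] p a b q = trans (detL-[]-∷ p a (b ∷ q)) (sym (cong -_ (detL-[]-∷ p b (a ∷ q))))
  detL-swap (x ∷ xs) p a b q = expand-swap xs (detL-swap xs) x [] p a b q

  detL-move : ∀ xs p c u w → detL f xs (p ++ c ∷ u ++ w) ≡ sgn (length u) * detL f xs (p ++ u ++ c ∷ w)
  detL-move xs p c [] w = sym (*-identityˡ _)
  detL-move xs p c (v ∷ u) w = begin
    detL f xs (p ++ c ∷ v ∷ u ++ w)                          ≡⟨ detL-swap xs p c v (u ++ w) ⟩
    - detL f xs (p ++ v ∷ c ∷ u ++ w)                        ≡⟨ cong (λ l → - detL f xs l) (sym (++-assoc p [ v ] (c ∷ u ++ w))) ⟩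
    - detL f xs ((p ++ [ v ]) ++ c ∷ u ++ w)                 ≡⟨ cong -_ (detL-move xs (p ++ [ v ]) c u w) ⟩
    - (sgn (length u) * detL f xs ((p ++ [ v ]) ++ u ++ c ∷ w)) ≡⟨ cong (λ l → - (sgn (length u) * detL f xs l)) (++-assoc p [ v ] (u ++ c ∷ w)) ⟩
    - (sgn (length u) * detL f xs (p ++ v ∷ u ++ c ∷ w))     ≡⟨ neg-distribˡ-* (sgn (length u)) _ ⟩
    - sgn (length u) * detL f xs (p ++ v ∷ u ++ c ∷ w)       ∎
    where open ≡-Reasoning

  detL-repeated : ∀ xs p a u w → detL f xs (p ++ a ∷ u ++ a ∷ w) ≡ 0ℚ
  detL-repeated xs p a u w = trans (detL-move xs p a u (a ∷ w))
    (trans (cong (λ l → sgn (length u) * detL f xs l) (sym (++-assoc p u (a ∷ a ∷ w))))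
      (trans (cong (sgn (length u) *_) (x≡-x⇒x≡0 (detL-swap xs (p ++ u) a a w))) (*-zeroʳ (sgn (length u)))))

  detL-∈ : ∀ xs P h Q → (h ∈ P ⊎ h ∈ Q) → detL f xs (P ++ h ∷ Q) ≡ 0ℚ
  detL-∈ xs P h Q (inj₂ h∈Q) with ∈-∃++ h∈Q
  ... | u , w , refl = detL-repeated xs P h u w
  detL-∈ xs P h Q (inj₁ h∈P) with ∈-∃++ h∈P
  ... | u , w , refl = trans (cong (detL f xs) (++-assoc u (h ∷ w) (h ∷ Q))) (detL-repeated xs u h w Q)

  private
    detL-↭-framed : ∀ {cs cs'} (p : cs ↭ cs') xs P Q → detL f xs (P ++ cs ++ Q) ≡ sgn (swaps p) * detL f xs (P ++ cs' ++ Q)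
    detL-↭-framed ↭.refl xs P Q = sym (*-identityˡ _)
    detL-↭-framed (↭.prep x p) xs P Q = trans (cong (detL f xs) (sym (++-assoc P [ x ] _)))
      (trans (detL-↭-framed p xs (P ++ [ x ]) Q) (cong (λ z → sgn (swaps p) * detL f xs z) (++-assoc P [ x ] _)))
    detL-↭-framed (↭.swap {xs = cs} {ys = cs'} x y p) xs P Q = begin
      detL f xs (P ++ x ∷ y ∷ cs ++ Q)                       ≡⟨ detL-swap xs P x y (cs ++ Q) ⟩
      - detL f xs (P ++ y ∷ x ∷ cs ++ Q)                     ≡⟨ cong (λ z → - detL f xs z) (sym (++-assoc P (y ∷ x ∷ []) (cs ++ Q))) ⟩
      - detL f xs ((P ++ y ∷ x ∷ []) ++ cs ++ Q)             ≡⟨ cong -_ (detL-↭-framed p xs (P ++ y ∷ x ∷ []) Q) ⟩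
      - (sgn (swaps p) * detL f xs ((P ++ y ∷ x ∷ []) ++ cs' ++ Q))
        ≡⟨ cong (λ z → - (sgn (swaps p) * detL f xs z)) (++-assoc P (y ∷ x ∷ []) (cs' ++ Q)) ⟩
      - (sgn (swaps p) * detL f xs (P ++ y ∷ x ∷ cs' ++ Q))  ≡⟨ neg-distribˡ-* (sgn (swaps p)) _ ⟩
      - sgn (swaps p) * detL f xs (P ++ y ∷ x ∷ cs' ++ Q)    ∎
      where open ≡-Reasoning
    detL-↭-framed (↭.trans p q) xs P Q = begin
      detL f xs (P ++ _ ++ Q)                                         ≡⟨ detL-↭-framed p xs P Q ⟩
      sgn (swaps p) * detL f xs (P ++ _ ++ Q)                         ≡⟨ cong (sgn (swaps p) *_) (detL-↭-framed q xs P Q) ⟩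
      sgn (swaps p) * (sgn (swaps q) * detL f xs (P ++ _ ++ Q))       ≡⟨ sym (*-assoc (sgn (swaps p)) (sgn (swaps q)) _) ⟩
      sgn (swaps p) * sgn (swaps q) * detL f xs (P ++ _ ++ Q)         ≡⟨ cong (_* detL f xs (P ++ _ ++ Q)) (sym (sgn-+ (swaps p) (swaps q))) ⟩
      sgn (swaps p ℕ.+ swaps q) * detL f xs (P ++ _ ++ Q)             ∎
      where open ≡-Reasoning

  detL-↭ : ∀ {cs cs'} (p : cs ↭ cs') xs → detL f xs cs ≡ sgn (swaps p) * detL f xs cs'
  detL-↭ {cs} {cs'} p xs = subst₂ (λ u w → detL f xs u ≡ sgn (swaps p) * detL f xs w)
    (++-identityʳ cs) (++-identityʳ cs') (detL-↭-framed p xs [] [])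

  private
    detL-concatMap-framed : ∀ {A : Set} (F G : A → List Col) (c : ℚ) →
      (∀ a xs P Q → detL f xs (P ++ F a ++ Q) ≡ c * detL f xs (P ++ G a ++ Q)) →
      ∀ l xs P Q → detL f xs (P ++ concatMap F l ++ Q) ≡ (c ^ℚ length l) * detL f xs (P ++ concatMap G l ++ Q)
    detL-concatMap-framed F G c step [] xs P Q = sym (*-identityˡ _)
    detL-concatMap-framed F G c step (a ∷ l) xs P Q = begin
      detL f xs (P ++ (F a ++ concatMap F l) ++ Q)             ≡⟨ cong (λ z → detL f xs (P ++ z)) (++-assoc (F a) _ Q) ⟩
      detL f xs (P ++ F a ++ concatMap F l ++ Q)               ≡⟨ step a xs P (concatMap F l ++ Q) ⟩
      c * detL f xs (P ++ G a ++ concatMap F l ++ Q)           ≡⟨ cong (λ z → c * detL f xs z) (sym (++-assoc P (G a) _)) ⟩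
      c * detL f xs ((P ++ G a) ++ concatMap F l ++ Q)         ≡⟨ cong (c *_) (detL-concatMap-framed F G c step l xs (P ++ G a) Q) ⟩
      c * (cˡ * detL f xs ((P ++ G a) ++ concatMap G l ++ Q))  ≡⟨ sym (*-assoc c cˡ _) ⟩
      c * cˡ * detL f xs ((P ++ G a) ++ concatMap G l ++ Q)
        ≡⟨ cong (λ z → c * cˡ * detL f xs z) (trans (++-assoc P (G a) _) (cong (P ++_) (sym (++-assoc (G a) _ Q)))) ⟩
      c * cˡ * detL f xs (P ++ (G a ++ concatMap G l) ++ Q)    ∎
      where
      open ≡-Reasoning
      cˡ : ℚ
      cˡ = c ^ℚ length l

  detL-concatMap : ∀ {A : Set} (F G : A → List Col) (c : ℚ) →
    (∀ a xs P Q → detL f xs (P ++ F a ++ Q) ≡ c * detL f xs (P ++ G a ++ Q)) →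
    ∀ l xs → detL f xs (concatMap F l) ≡ (c ^ℚ length l) * detL f xs (concatMap G l)
  detL-concatMap F G c step l xs = subst₂ (λ u w → detL f xs u ≡ (c ^ℚ length l) * detL f xs w)
    (++-identityʳ (concatMap F l)) (++-identityʳ (concatMap G l)) (detL-concatMap-framed F G c step l xs [] [])

  module _ (a' a h : Col) (l m : ℚ) (a'≡ : ∀ x → f x a' ≡ l * f x a + m * f x h) where

    private
      Linear : List R → Set
      Linear xs = ∀ p q → detL f xs (p ++ a' ∷ q) ≡ l * detL f xs (p ++ a ∷ q) + m * detL f xs (p ++ h ∷ q)

      expand-linear-pre : ∀ xs → Linear xs → ∀ x P Q cs →
        expand x xs (P ++ a' ∷ Q) cs ≡ l * expand x xs (P ++ a ∷ Q) cs + m * expand x xs (P ++ h ∷ Q) cs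
      expand-linear-pre xs ih x P Q cs = trans (sumFin-cong (length cs) λ j → trans
          (cong (λ d → sgn (toℕ j) * f x (lookup cs j) * d)
            (trans (cong (detL f xs) (++-assoc P (a' ∷ Q) (removeAt cs j)))
              (trans (ih P (Q ++ removeAt cs j))
                (cong₂ (λ u v → l * detL f xs u + m * detL f xs v)
                  (sym (++-assoc P (a ∷ Q) (removeAt cs j))) (sym (++-assoc P (h ∷ Q) (removeAt cs j)))))))
          (solve 6 (λ s g l m da dh → s :* g :* (l :* da :+ m :* dh) := l :* (s :* g :* da) :+ m :* (s :* g :* dh)) refl
             (sgn (toℕ j)) (f x (lookup cs j)) l m (detL f xs ((P ++ a ∷ Q) ++ removeAt cs j)) (detL f xs ((P ++ h ∷ Q) ++ removeAt cs j))))
        (sumFin-linear (length cs) l m _ _)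

      expand-linear : ∀ xs → Linear xs → ∀ x pre p q →
        expand x xs pre (p ++ a' ∷ q) ≡ l * expand x xs pre (p ++ a ∷ q) + m * expand x xs pre (p ++ h ∷ q)
      expand-linear xs ih x pre [] q = begin
        expand x xs pre (a' ∷ q)         ≡⟨ expand-∷ x xs pre a' q ⟩
        f x a' * D + - expand x xs (pre ++ a' ∷ []) q
          ≡⟨ cong₂ (λ u v → u * D + - v) (a'≡ x) (expand-linear-pre xs ih x pre [] q) ⟩
        (l * f x a + m * f x h) * D + - (l * Ea + m * Eh)
          ≡⟨ solve 7 (λ l m fa fh d ea eh → (l :* fa :+ m :* fh) :* d :+ (:- (l :* ea :+ m :* eh))
                                           := l :* (fa :* d :+ (:- ea)) :+ m :* (fh :* d :+ (:- eh))) refl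
               l m (f x a) (f x h) D Ea Eh ⟩
        l * (f x a * D + - Ea) + m * (f x h * D + - Eh)
          ≡⟨ cong₂ (λ u v → l * u + m * v) (sym (expand-∷ x xs pre a q)) (sym (expand-∷ x xs pre h q)) ⟩
        l * expand x xs pre (a ∷ q) + m * expand x xs pre (h ∷ q) ∎
        where
        open ≡-Reasoning
        D Ea Eh : ℚ
        D = detL f xs (pre ++ q)
        Ea = expand x xs (pre ++ a ∷ []) q
        Eh = expand x xs (pre ++ h ∷ []) q
      expand-linear xs ih x pre (c ∷ p) q = begin
        expand x xs pre (c ∷ (p ++ a' ∷ q))  ≡⟨ expand-∷ x xs pre c (p ++ a' ∷ q) ⟩
        f x c * detL f xs (pre ++ p ++ a' ∷ q) + - expand x xs (pre ++ [ c ]) (p ++ a' ∷ q)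
          ≡⟨ cong₂ (λ u v → f x c * u + - v)
               (trans (cong (detL f xs) (sym (++-assoc pre p (a' ∷ q))))
                 (trans (ih (pre ++ p) q) (cong₂ (λ u v → l * detL f xs u + m * detL f xs v) (++-assoc pre p (a ∷ q)) (++-assoc pre p (h ∷ q)))))
               (expand-linear xs ih x (pre ++ [ c ]) p q) ⟩
        f x c * (l * Da + m * Dh) + - (l * Ea + m * Eh)
          ≡⟨ solve 7 (λ g l m da dh ea eh → g :* (l :* da :+ m :* dh) :+ (:- (l :* ea :+ m :* eh))
                                           := l :* (g :* da :+ (:- ea)) :+ m :* (g :* dh :+ (:- eh))) refl
               (f x c) l m Da Dh Ea Eh ⟩
        l * (f x c * Da + - Ea) + m * (f x c * Dh + - Eh)
          ≡⟨ cong₂ (λ u v → l * u + m * v) (sym (expand-∷ x xs pre c (p ++ a ∷ q))) (sym (expand-∷ x xs pre c (p ++ h ∷ q))) ⟩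
        l * expand x xs pre (c ∷ (p ++ a ∷ q)) + m * expand x xs pre (c ∷ (p ++ h ∷ q)) ∎
        where
        open ≡-Reasoning
        Da Dh Ea Eh : ℚ
        Da = detL f xs (pre ++ p ++ a ∷ q)
        Dh = detL f xs (pre ++ p ++ h ∷ q)
        Ea = expand x xs (pre ++ [ c ]) (p ++ a ∷ q)
        Eh = expand x xs (pre ++ [ c ]) (p ++ h ∷ q)

    detL-linear : ∀ xs p q → detL f xs (p ++ a' ∷ q) ≡ l * detL f xs (p ++ a ∷ q) + m * detL f xs (p ++ h ∷ q)
    detL-linear [] p q = trans (detL-[]-∷ p a' q)
      (sym (trans (cong₂ (λ u v → l * u + m * v) (detL-[]-∷ p a q) (detL-[]-∷ p h q))
        (solve 2 (λ l m → l :* con 0ℚ :+ m :* con 0ℚ := con 0ℚ) refl l m)))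
    detL-linear (x ∷ xs) p q = expand-linear xs (detL-linear xs) x [] p q

  -- The m * hh u part of new u only contributes determinants with a repeated column.
  detL-addColumns : ∀ {A : Set} (old new hh : A → Col) (l m : ℚ) →
    (∀ u x → f x (new u) ≡ l * f x (old u) + m * f x (hh u)) →
    ∀ xs P U Q → (∀ u → u ∈ U → hh u ∈ P ⊎ hh u ∈ Q) →
    detL f xs (P ++ map new U ++ Q) ≡ (l ^ℚ length U) * detL f xs (P ++ map old U ++ Q)
  detL-addColumns old new hh l m new≡ xs P [] Q hh∈ = sym (*-identityˡ _)
  detL-addColumns old new hh l m new≡ xs P (u ∷ U) Q hh∈ = begin
    detL f xs (P ++ new u ∷ map new U ++ Q)      ≡⟨ cong (detL f xs) (sym (++-assoc P [ new u ] (map new U ++ Q))) ⟩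
    detL f xs ((P ++ [ new u ]) ++ map new U ++ Q)
      ≡⟨ detL-addColumns old new hh l m new≡ xs (P ++ [ new u ]) U Q hh∈' ⟩
    L * detL f xs ((P ++ [ new u ]) ++ map old U ++ Q) ≡⟨ cong (λ z → L * detL f xs z) (++-assoc P [ new u ] (map old U ++ Q)) ⟩
    L * detL f xs (P ++ new u ∷ map old U ++ Q)
      ≡⟨ cong (L *_) (detL-linear (new u) (old u) (hh u) l m (new≡ u) xs P (map old U ++ Q)) ⟩
    L * (l * detL f xs (P ++ old u ∷ map old U ++ Q) + m * detL f xs (P ++ hh u ∷ map old U ++ Q))
      ≡⟨ cong (λ z → L * (l * detL f xs (P ++ old u ∷ map old U ++ Q) + m * z)) (detL-∈ xs P (hh u) (map old U ++ Q) hh-u∈) ⟩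
    L * (l * detL f xs (P ++ old u ∷ map old U ++ Q) + m * 0ℚ)
      ≡⟨ solve 4 (λ L l m d → L :* (l :* d :+ m :* con 0ℚ) := (l :* L) :* d) refl L l m (detL f xs (P ++ old u ∷ map old U ++ Q)) ⟩
    (l * L) * detL f xs (P ++ old u ∷ map old U ++ Q) ∎
    where
    open ≡-Reasoning
    L : ℚ
    L = l ^ℚ length U
    hh∈' : ∀ u' → u' ∈ U → hh u' ∈ (P ++ [ new u ]) ⊎ hh u' ∈ Q
    hh∈' u' u'∈U with hh∈ u' (there u'∈U)
    ... | inj₁ p = inj₁ (∈-++⁺ˡ p)
    ... | inj₂ q = inj₂ q
    hh-u∈ : hh u ∈ P ⊎ hh u ∈ map old U ++ Q
    hh-u∈ with hh∈ u (here refl)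
    ... | inj₁ p = inj₁ p
    ... | inj₂ q = inj₂ (∈-++⁺ʳ (map old U) q)

  module _ (PR : R → Set) (PC : Col → Set) (zero-block : ∀ x c → PR x → PC c → f x c ≡ 0ℚ) where

    private
      BlockTriangular : List R → Set
      BlockTriangular xs = ∀ ys as bs → length xs ≡ length as → All PR xs → All PC bs →
                           detL f (xs ++ ys) (as ++ bs) ≡ detL f xs as * detL f ys bs

      expand-block : ∀ xs → BlockTriangular xs → ∀ x ys bs → PR x → All PR xs → All PC bs → ∀ pre as →
                     suc (length xs) ≡ length (pre ++ as) →
                     expand x (xs ++ ys) pre (as ++ bs) ≡ expand x xs pre as * detL f ys bs
      expand-block xs ih x ys bs px prs pcs pre [] len =
        trans (sumFin-zero (length bs) _ (λ j → trans (cong (λ z → sgn (toℕ j) * z * detL f (xs ++ ys) (pre ++ removeAt bs j))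
                   (zero-block x (lookup bs j) px (All.lookup pcs (∈-lookup j))))
                   (solve 2 (λ s d → s :* con 0ℚ :* d := con 0ℚ) refl (sgn (toℕ j)) (detL f (xs ++ ys) (pre ++ removeAt bs j)))))
          (sym (*-zeroˡ (detL f ys bs)))
      expand-block xs ih x ys bs px prs pcs pre (a ∷ as) len = begin
        expand x (xs ++ ys) pre (a ∷ as ++ bs)    ≡⟨ expand-∷ x (xs ++ ys) pre a (as ++ bs) ⟩
        f x a * detL f (xs ++ ys) (pre ++ as ++ bs) + - expand x (xs ++ ys) (pre ++ [ a ]) (as ++ bs)
          ≡⟨ cong₂ (λ u v → f x a * u + - v)
               (trans (cong (detL f (xs ++ ys)) (sym (++-assoc pre as bs))) (ih ys (pre ++ as) bs len₁ prs pcs))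
               (expand-block xs ih x ys bs px prs pcs (pre ++ [ a ]) as len₂) ⟩
        f x a * (detL f xs (pre ++ as) * Dy) + - (expand x xs (pre ++ [ a ]) as * Dy)
          ≡⟨ solve 4 (λ g d e y → g :* (d :* y) :+ (:- (e :* y)) := (g :* d :+ (:- e)) :* y) refl
               (f x a) (detL f xs (pre ++ as)) (expand x xs (pre ++ [ a ]) as) Dy ⟩
        (f x a * detL f xs (pre ++ as) + - expand x xs (pre ++ [ a ]) as) * Dy
          ≡⟨ cong (_* Dy) (sym (expand-∷ x xs pre a as)) ⟩
        expand x xs pre (a ∷ as) * Dy ∎
        where
        open ≡-Reasoning
        Dy : ℚ
        Dy = detL f ys bs
        len₁ : length xs ≡ length (pre ++ as)
        len₁ = ℕP.suc-injective (trans len (trans (length-++ pre)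
          (trans (ℕP.+-suc (length pre) (length as)) (cong suc (sym (length-++ pre))))))
        len₂ : suc (length xs) ≡ length ((pre ++ [ a ]) ++ as)
        len₂ = trans len (cong length (sym (++-assoc pre [ a ] as)))

    detL-blockTriangular : ∀ xs ys as bs → length xs ≡ length as → All PR xs → All PC bs →
                           detL f (xs ++ ys) (as ++ bs) ≡ detL f xs as * detL f ys bs
    detL-blockTriangular [] ys [] bs len prs pcs = sym (*-identityˡ _)
    detL-blockTriangular (x ∷ xs) ys as bs len (px ∷ prs) pcs =
      expand-block xs (detL-blockTriangular xs) x ys bs px prs pcs [] as len

module _ {R Col : Set} (f g : R → Col → ℚ) (PR : R → Set) (PC : Col → Set)
         (f≡g : ∀ x c → PR x → PC c → f x c ≡ g x c) where

  private
    expand-cong : ∀ xs → (∀ cs → All PC cs → detL f xs cs ≡ detL g xs cs) → ∀ x → PR x → ∀ pre cs →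
                  All PC (pre ++ cs) → expand f x xs pre cs ≡ expand g x xs pre cs
    expand-cong xs ih x px pre [] pcs = refl
    expand-cong xs ih x px pre (c ∷ cs) pcs = trans (expand-∷ f x xs pre c cs) (trans
      (cong₂ (λ u v → u * v + - expand f x xs (pre ++ [ c ]) cs) (f≡g x c px (All.head (AllP.++⁻ʳ pre pcs)))
        (ih (pre ++ cs) (AllP.++⁺ (AllP.++⁻ˡ pre pcs) (All.tail (AllP.++⁻ʳ pre pcs)))))
      (trans (cong (λ z → g x c * detL g xs (pre ++ cs) + - z)
        (expand-cong xs ih x px (pre ++ [ c ]) cs (subst (All PC) (sym (++-assoc pre [ c ] cs)) pcs)))
        (sym (expand-∷ g x xs pre c cs))))

  detL-cong : ∀ xs cs → All PR xs → All PC cs → detL f xs cs ≡ detL g xs cs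
  detL-cong [] [] _ _ = refl
  detL-cong [] (_ ∷ _) _ _ = refl
  detL-cong (x ∷ xs) cs (px ∷ prs) pcs = expand-cong xs (λ cs' → detL-cong xs cs' prs) x px [] cs pcs

module _ {R Col Col' : Set} (f : R → Col' → ℚ) (φ : Col → Col') where

  private
    expand-map : ∀ xs → (∀ cs → detL f xs (map φ cs) ≡ detL (λ x c → f x (φ c)) xs cs) → ∀ x pre cs →
                 expand f x xs (map φ pre) (map φ cs) ≡ expand (λ x c → f x (φ c)) x xs pre cs
    expand-map xs ih x pre [] = refl
    expand-map xs ih x pre (c ∷ cs) = trans (expand-∷ f x xs (map φ pre) (φ c) (map φ cs))
      (trans (cong₂ (λ u v → f x (φ c) * u + - v)
                (trans (cong (detL f xs) (sym (map-++ φ pre cs))) (ih (pre ++ cs)))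
                (trans (cong (λ P → expand f x xs P (map φ cs)) (sym (map-++ φ pre [ c ]))) (expand-map xs ih x (pre ++ [ c ]) cs)))
        (sym (expand-∷ (λ x c → f x (φ c)) x xs pre c cs)))

  detL-map : ∀ xs cs → detL f xs (map φ cs) ≡ detL (λ x c → f x (φ c)) xs cs
  detL-map [] [] = refl
  detL-map [] (_ ∷ _) = refl
  detL-map (x ∷ xs) cs = expand-map xs (detL-map xs) x [] cs

interval : ℕ → ℕ → List ℕ
interval a zero = []
interval a (suc n) = suc a ∷ interval (suc a) n

oneTo≡interval : ∀ n → oneTo n ≡ interval 0 n
oneTo≡interval n = trans (map-upTo suc n) (applyUpTo≡interval suc 0 n (λ i → refl))
  where
  applyUpTo≡interval : ∀ (f : ℕ → ℕ) a n → (∀ i → f i ≡ suc (a ℕ.+ i)) → applyUpTo f n ≡ interval a n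
  applyUpTo≡interval f a zero f≡ = refl
  applyUpTo≡interval f a (suc n) f≡ = cong₂ _∷_ (trans (f≡ 0) (cong suc (ℕP.+-identityʳ a)))
    (applyUpTo≡interval (f ∘′ suc) (suc a) n (λ i → trans (f≡ (suc i)) (cong suc (ℕP.+-suc a i))))

length-interval : ∀ a n → length (interval a n) ≡ n
length-interval a zero = refl
length-interval a (suc n) = cong suc (length-interval (suc a) n)

interval-+ : ∀ a b c → interval a (b ℕ.+ c) ≡ interval a b ++ interval (a ℕ.+ b) c
interval-+ a zero c = cong (λ z → interval z c) (sym (ℕP.+-identityʳ a))
interval-+ a (suc b) c = cong (suc a ∷_)
  (trans (interval-+ (suc a) b c) (cong (λ z → interval (suc a) b ++ interval z c) (sym (ℕP.+-suc a b))))

interval-bounds : ∀ a n → All (λ v → suc a ≤ v × v ≤ a ℕ.+ n) (interval a n)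
interval-bounds a zero = []
interval-bounds a (suc n) = (ℕP.≤-refl , subst (suc a ≤_) (sym (ℕP.+-suc a n)) (s≤s (ℕP.m≤m+n a n)))
  ∷ All.map (λ {v} (a<v , v≤) → ℕP.<⇒≤ a<v , subst (v ≤_) (sym (ℕP.+-suc a n)) v≤) (interval-bounds (suc a) n)

reverse-interval : ∀ a n → reverse (interval a n) ≡ map (λ v → suc (a ℕ.+ n) ∸ v) (interval 0 n)
reverse-interval a zero = refl
reverse-interval a (suc n) = begin
  reverse (suc a ∷ interval (suc a) n)                     ≡⟨ unfold-reverse (suc a) (interval (suc a) n) ⟩
  reverse (interval (suc a) n) ++ [ suc a ]                ≡⟨ cong (_++ [ suc a ]) (reverse-interval (suc a) n) ⟩
  map (λ v → suc (suc a ℕ.+ n) ∸ v) (interval 0 n) ++ [ suc a ]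
    ≡⟨ cong₂ _++_ (map-cong (λ v → cong (λ z → suc z ∸ v) (sym (ℕP.+-suc a n))) (interval 0 n)) (cong [_] (sym last≡)) ⟩
  map g (interval 0 n) ++ [ g (suc n) ]                    ≡⟨ sym (map-++ g (interval 0 n) [ suc n ]) ⟩
  map g (interval 0 n ++ interval n 1)                     ≡⟨ cong (map g) (sym (trans (cong (interval 0) (ℕP.+-comm 1 n)) (interval-+ 0 n 1))) ⟩
  map g (interval 0 (suc n))                               ∎
  where
  open ≡-Reasoning
  g : ℕ → ℕ
  g v = suc (a ℕ.+ suc n) ∸ v
  last≡ : g (suc n) ≡ suc a
  last≡ = trans (cong (_∸ n) (trans (ℕP.+-suc a n) (ℕP.+-comm (suc a) n))) (ℕP.m+n∸m≡n n (suc a))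

concatMap-↭ : ∀ {A B : Set} {F G : A → List B} (l : List A) → (∀ a → F a ↭ G a) → concatMap F l ↭ concatMap G l
concatMap-↭ [] F↭G = ↭-refl
concatMap-↭ (a ∷ l) F↭G = ↭P.++⁺ (F↭G a) (concatMap-↭ l F↭G)

concatMap-++-↭ : ∀ {A B : Set} (F G : A → List B) (l : List A) →
                 concatMap (λ a → F a ++ G a) l ↭ concatMap F l ++ concatMap G l
concatMap-++-↭ F G [] = ↭-refl
concatMap-++-↭ F G (a ∷ l) = ↭-trans (↭-reflexive (++-assoc (F a) (G a) _))
  (↭-trans (↭P.++⁺ˡ (F a) (↭-trans (↭P.++⁺ˡ (G a) (concatMap-++-↭ F G l)) (↭P.shifts (G a) (concatMap F l))))
    (↭-reflexive (sym (++-assoc (F a) (concatMap F l) (G a ++ concatMap G l)))))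

All-concatMap : ∀ {A B : Set} {P : B → Set} (F : A → List B) (l : List A) → (∀ a → All P (F a)) → All P (concatMap F l)
All-concatMap F l all-F = AllP.concat⁺ (AllP.map⁺ (All.universal all-F l))

All-take-tabulate : ∀ {A : Set} {P : A → Set} n N (f : Fin n → A) → (∀ t → toℕ t < N → P (f t)) → All P (take N (tabulate f))
All-take-tabulate zero N f h = AllP.take⁺ N []
All-take-tabulate (suc n) zero f h = []
All-take-tabulate (suc n) (suc N) f h = h Fin.zero (s≤s z≤n) ∷ All-take-tabulate n N (f ∘′ Fin.suc) (λ t lt → h (Fin.suc t) (s≤s lt))

All-drop-tabulate : ∀ {A : Set} {P : A → Set} n N (f : Fin n → A) → (∀ t → N ≤ toℕ t → P (f t)) → All P (drop N (tabulate f))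
All-drop-tabulate n zero f h = AllP.tabulate⁺ (λ t → h t z≤n)
All-drop-tabulate zero (suc N) f h = []
All-drop-tabulate (suc n) (suc N) f h = All-drop-tabulate n N (f ∘′ Fin.suc) (λ t le → h (Fin.suc t) (s≤s le))


isEven-+-odd : ∀ a b → isEven a ≡ false → isEven (a ℕ.+ b) ≡ not (isEven b)
isEven-+-odd (suc zero) b _ = isEven-suc b
  where
  isEven-suc : ∀ b → isEven (suc b) ≡ not (isEven b)
  isEven-suc zero = refl
  isEven-suc (suc b) = trans (sym (not-involutive (isEven b))) (cong not (sym (isEven-suc b)))
isEven-+-odd (suc (suc a)) b odd = isEven-+-odd a b odd

isEven-+-even : ∀ a b → isEven a ≡ true → isEven (a ℕ.+ b) ≡ isEven b
isEven-+-even zero b _ = refl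
isEven-+-even (suc (suc a)) b even = isEven-+-even a b even

%2≡1⇒odd : ∀ x → x ℕ.% 2 ≡ 1 → isEven x ≡ false
%2≡1⇒odd (suc zero) _ = refl
%2≡1⇒odd (suc (suc x)) eq = %2≡1⇒odd x eq

%2≡0⇒even : ∀ x → x ℕ.% 2 ≡ 0 → isEven x ≡ true
%2≡0⇒even zero _ = refl
%2≡0⇒even (suc (suc x)) eq = %2≡0⇒even x eq

⌊+double/2⌋ : ∀ m c → ⌊ m ℕ.+ (c ℕ.+ c) /2⌋ ≡ ⌊ m /2⌋ ℕ.+ c
⌊+double/2⌋ m zero = trans (cong ⌊_/2⌋ (ℕP.+-identityʳ m)) (sym (ℕP.+-identityʳ _))
⌊+double/2⌋ m (suc c) = trans (cong ⌊_/2⌋ eq) (trans (cong suc (⌊+double/2⌋ m c)) (sym (ℕP.+-suc _ c)))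
  where
  eq : m ℕ.+ (suc c ℕ.+ suc c) ≡ suc (suc (m ℕ.+ (c ℕ.+ c)))
  eq = trans (cong (m ℕ.+_) (cong suc (ℕP.+-suc c c))) (trans (ℕP.+-suc m (suc (c ℕ.+ c))) (cong suc (ℕP.+-suc m (c ℕ.+ c))))

⌈n/2⌉≡⌊n/2⌋+parity : ∀ n → Σ ℕ (λ e → e ≤ 1 × ⌈ n /2⌉ ≡ ⌊ n /2⌋ ℕ.+ e)
⌈n/2⌉≡⌊n/2⌋+parity zero = 0 , z≤n , refl
⌈n/2⌉≡⌊n/2⌋+parity (suc zero) = 1 , s≤s z≤n , refl
⌈n/2⌉≡⌊n/2⌋+parity (suc (suc n)) with ⌈n/2⌉≡⌊n/2⌋+parity n
... | e , e≤1 , eq = e , e≤1 , cong suc eq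

length-concatMap-alternating : ∀ {B : Set} (F : ℕ → List B) a e → e ≤ 1 →
  (∀ m → length (F m) ≡ (if isEven m then a else a ℕ.+ e)) →
  ∀ n (g : ℕ → ℕ) → (∀ i → isEven (g i) ≡ isEven i) →
  length (concatMap F (applyUpTo g n)) ≡ ⌊ (a ℕ.+ (a ℕ.+ e)) ℕ.* n /2⌋
length-concatMap-alternating F a e e≤1 len-F zero g g-parity = cong ⌊_/2⌋ (sym (ℕP.*-zeroʳ (a ℕ.+ (a ℕ.+ e))))
length-concatMap-alternating F a e e≤1 len-F (suc zero) g g-parity = begin
  length (F (g 0) ++ [])                      ≡⟨ cong length (++-identityʳ (F (g 0))) ⟩
  length (F (g 0))                            ≡⟨ trans (len-F (g 0)) (cong (λ z → if z then a else a ℕ.+ e) (g-parity 0)) ⟩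
  a                                           ≡⟨ sym (⌊e/2⌋+a e e≤1) ⟩
  ⌊ e /2⌋ ℕ.+ a                               ≡⟨ sym (⌊+double/2⌋ e a) ⟩
  ⌊ e ℕ.+ (a ℕ.+ a) /2⌋                       ≡⟨ cong ⌊_/2⌋ (reorder a e) ⟩
  ⌊ (a ℕ.+ (a ℕ.+ e)) ℕ.* 1 /2⌋               ∎
  where
  open ≡-Reasoning
  ⌊e/2⌋+a : ∀ e → e ≤ 1 → ⌊ e /2⌋ ℕ.+ a ≡ a
  ⌊e/2⌋+a zero _ = refl
  ⌊e/2⌋+a (suc zero) _ = refl
  ⌊e/2⌋+a (suc (suc e)) (s≤s ())
  reorder : ∀ a e → e ℕ.+ (a ℕ.+ a) ≡ (a ℕ.+ (a ℕ.+ e)) ℕ.* 1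
  reorder = solve-∀
length-concatMap-alternating {B} F a e e≤1 len-F (suc (suc n)) g g-parity = begin
  length (F (g 0) ++ F (g 1) ++ rest)
    ≡⟨ trans (length-++ (F (g 0))) (cong (length (F (g 0)) ℕ.+_) (length-++ (F (g 1)))) ⟩
  length (F (g 0)) ℕ.+ (length (F (g 1)) ℕ.+ length rest)
    ≡⟨ cong₂ (λ x y → x ℕ.+ (y ℕ.+ length rest))
         (trans (len-F (g 0)) (cong (λ z → if z then a else a ℕ.+ e) (g-parity 0)))
         (trans (len-F (g 1)) (cong (λ z → if z then a else a ℕ.+ e) (g-parity 1))) ⟩
  a ℕ.+ (a ℕ.+ e ℕ.+ length rest)
    ≡⟨ cong (λ z → a ℕ.+ (a ℕ.+ e ℕ.+ z)) (length-concatMap-alternating F a e e≤1 len-F n (g ∘′ suc ∘′ suc) (λ i → g-parity (suc (suc i)))) ⟩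
  a ℕ.+ (a ℕ.+ e ℕ.+ ⌊ s ℕ.* n /2⌋)
    ≡⟨ reorder₁ a e ⌊ s ℕ.* n /2⌋ ⟩
  ⌊ s ℕ.* n /2⌋ ℕ.+ s                         ≡⟨ sym (⌊+double/2⌋ (s ℕ.* n) s) ⟩
  ⌊ s ℕ.* n ℕ.+ (s ℕ.+ s) /2⌋                 ≡⟨ cong ⌊_/2⌋ (reorder₂ s n) ⟩
  ⌊ s ℕ.* suc (suc n) /2⌋                     ∎
  where
  open ≡-Reasoning
  rest : List B
  rest = concatMap F (applyUpTo (g ∘′ suc ∘′ suc) n)
  s : ℕ
  s = a ℕ.+ (a ℕ.+ e)
  reorder₁ : ∀ a e h → a ℕ.+ (a ℕ.+ e ℕ.+ h) ≡ h ℕ.+ (a ℕ.+ (a ℕ.+ e))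
  reorder₁ = solve-∀
  reorder₂ : ∀ s n → s ℕ.* n ℕ.+ (s ℕ.+ s) ≡ s ℕ.* (2 ℕ.+ n)
  reorder₂ = solve-∀

-- Pairing each column with its mirror

interval-self-mirror : ∀ k e D' → e ≤ 1 → D' ≡ k ℕ.+ e ℕ.+ k → All (λ v → suc D' ∸ v ≡ v) (interval k e)
interval-self-mirror k zero D' _ _ = []
interval-self-mirror k (suc zero) D' _ refl = mirror ∷ []
  where
  mirror : suc (k ℕ.+ 1 ℕ.+ k) ∸ suc k ≡ suc k
  mirror = trans (cong (_∸ k) (ℕP.+-comm (k ℕ.+ 1) k)) (trans (ℕP.m+n∸m≡n k (k ℕ.+ 1)) (ℕP.+-comm k 1))
interval-self-mirror k (suc (suc e)) D' (s≤s ()) _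

OddRow EvenRow : ℕ → Set
OddRow x = isEven x ≡ false × 2 ≤ x
EvenRow x = isEven x ≡ true × 2 ≤ x

rows-parity : ∀ {n} N (α : Fin n → ℕ) → (∀ i j → i Fin.< j → α i < α j) → (∀ t → toℕ t ≡ 0 → 2 ≤ α t) →
  (∀ t → toℕ t < N → α t ℕ.% 2 ≡ 1) → (∀ t → N ≤ toℕ t → α t ℕ.% 2 ≡ 0) →
  All OddRow (take N (rowsOf n α)) × All EvenRow (drop N (rowsOf n α))
rows-parity {n} N α increasing first≥2 odd even = subst (λ rows → All OddRow (take N rows) × All EvenRow (drop N rows)) (sym rows≡)
  ( All-take-tabulate n N α (λ t t<N → %2≡1⇒odd (α t) (odd t t<N) , ≥2 t)
  , All-drop-tabulate n N α (λ t N≤t → %2≡0⇒even (α t) (even t N≤t) , ≥2 t))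
  where
  rows≡ : rowsOf n α ≡ tabulate α
  rows≡ = map-tabulate id α
  ≥2 : ∀ t → 2 ≤ α t
  ≥2 t with toℕ t in t≡
  ... | zero = first≥2 t t≡
  ... | suc _ = ℕP.≤-trans (first≥2 t₀ (toℕ-fromℕ< 0<n)) (ℕP.<⇒≤ (increasing t₀ t t₀<t))
    where
    0<n : 0 < n
    0<n = ℕP.≤-trans (s≤s z≤n) (toℕ<n t)
    t₀ : Fin n
    t₀ = Fin.fromℕ< 0<n
    t₀<t : t₀ Fin.< t
    t₀<t = subst₂ _<_ (sym (toℕ-fromℕ< 0<n)) (sym t≡) (s≤s z≤n)

data Tag : Set where
  plain halfSum halfDiff : Tag

Label : Set
Label = (ℕ × ℕ) × Tag

module Pairing (D' k e : ℕ) (e≤1 : e ≤ 1) (D'≡ : D' ≡ k ℕ.+ e ℕ.+ k)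
               (kk≡ : kk (suc D') ≡ k) (kbar≡ : kbar (suc D') ≡ k ℕ.+ e) where

  D : ℕ
  D = suc D'

  entry± : ℕ → Label → ℚ
  entry± x (c , plain) = entry D x c
  entry± x ((m , v) , halfSum) = ½ * (entry D x (m , v) + entry D x (m , D ∸ v))
  entry± x ((m , v) , halfDiff) = ½ * (entry D x (m , v) - entry D x (m , D ∸ v))

  v/D+[D-v]/D≡1 : ∀ v → v ≤ D → ℕtoℚ v * invℕ D + ℕtoℚ (D ∸ v) * invℕ D ≡ 1ℚ
  v/D+[D-v]/D≡1 v v≤D = trans (sym (*-distribʳ-+ (invℕ D) (ℕtoℚ v) (ℕtoℚ (D ∸ v))))
    (trans (cong (_* invℕ D) (sym (ℕtoℚ-+ v (D ∸ v))))
      (trans (cong (λ z → ℕtoℚ z * invℕ D) (ℕP.m+[n∸m]≡n v≤D)) (ℕtoℚ-*-invℕ D')))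

  entry-mirror-even : ∀ x m v → v ≤ D → isEven (x ℕ.+ m) ≡ true → entry D x (m , D ∸ v) ≡ entry D x (m , v)
  entry-mirror-even x m v v≤D even =
    cong (_* invℕ (x ℕ.+ m)) (bernTilde-reflect-even D (x ℕ.+ m) _ _ (v/D+[D-v]/D≡1 v v≤D) even)

  entry-mirror-odd : ∀ x m v → v ≤ D → isEven (x ℕ.+ m) ≡ false → 2 ≤ x ℕ.+ m →
                     entry D x (m , D ∸ v) ≡ - entry D x (m , v)
  entry-mirror-odd x m v v≤D odd 2≤ =
    trans (cong (_* invℕ (x ℕ.+ m)) (bernTilde-reflect-odd D (x ℕ.+ m) _ _ (v/D+[D-v]/D≡1 v v≤D) odd 2≤))
      (sym (neg-distribˡ-* (bernTilde D (x ℕ.+ m) (ℕtoℚ v * invℕ D)) (invℕ (x ℕ.+ m))))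

  module _ (x m v : ℕ) (v≤D : v ≤ D) where

    halfSum-even : isEven (x ℕ.+ m) ≡ true → entry± x ((m , v) , halfSum) ≡ entry D x (m , v)
    halfSum-even even = trans (cong (λ z → ½ * (entry D x (m , v) + z)) (entry-mirror-even x m v v≤D even))
      (solve 1 (λ a → con ½ :* (a :+ a) := a) refl (entry D x (m , v)))

    halfSum-odd : isEven (x ℕ.+ m) ≡ false → 2 ≤ x ℕ.+ m → entry± x ((m , v) , halfSum) ≡ 0ℚ
    halfSum-odd odd 2≤ = trans (cong (λ z → ½ * (entry D x (m , v) + z)) (entry-mirror-odd x m v v≤D odd 2≤))
      (solve 1 (λ a → con ½ :* (a :+ (:- a)) := con 0ℚ) refl (entry D x (m , v)))

    halfDiff-even : isEven (x ℕ.+ m) ≡ true → entry± x ((m , v) , halfDiff) ≡ 0ℚ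
    halfDiff-even even = trans (cong (λ z → ½ * (entry D x (m , v) - z)) (entry-mirror-even x m v v≤D even))
      (solve 1 (λ a → con ½ :* (a :- a) := con 0ℚ) refl (entry D x (m , v)))

    halfDiff-odd : isEven (x ℕ.+ m) ≡ false → 2 ≤ x ℕ.+ m → entry± x ((m , v) , halfDiff) ≡ entry D x (m , v)
    halfDiff-odd odd 2≤ = trans (cong (λ z → ½ * (entry D x (m , v) - z)) (entry-mirror-odd x m v v≤D odd 2≤))
      (solve 1 (λ a → con ½ :* (a :- (:- a)) := a) refl (entry D x (m , v)))

  self-mirror-odd : ∀ x m v → D ∸ v ≡ v → isEven (x ℕ.+ m) ≡ false → 2 ≤ x ℕ.+ m → entry D x (m , v) ≡ 0ℚ
  self-mirror-odd x m v mirror odd 2≤ = x≡-x⇒x≡0 (trans (cong (λ w → entry D x (m , w)) (sym mirror))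
    (entry-mirror-odd x m v (subst (_≤ D) mirror (ℕP.m∸n≤m D v)) odd 2≤))

  U Mid : List ℕ
  U = interval 0 k
  Mid = interval k e

  U-bounded : All (_≤ D) U
  U-bounded = All.map (λ (_ , v≤k) → ℕP.≤-trans v≤k k≤D) (interval-bounds 0 k)
    where
    k≤D : k ≤ D
    k≤D = ℕP.≤-trans (ℕP.m≤n+m k (k ℕ.+ e)) (ℕP.≤-trans (ℕP.≤-reflexive (sym D'≡)) (ℕP.n≤1+n D'))

  interval-split-mirror : interval 0 D' ↭ U ++ Mid ++ map (D ∸_) U
  interval-split-mirror = ↭-trans (↭-reflexive split) (↭P.++⁺ˡ U (↭P.++⁺ˡ Mid top↭))
    where
    split : interval 0 D' ≡ U ++ Mid ++ interval (k ℕ.+ e) k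
    split = trans (cong (interval 0) D'≡) (trans (interval-+ 0 (k ℕ.+ e) k)
      (trans (cong (_++ interval (k ℕ.+ e) k) (interval-+ 0 k e)) (++-assoc U Mid (interval (k ℕ.+ e) k))))
    top↭ : interval (k ℕ.+ e) k ↭ map (D ∸_) U
    top↭ = ↭-trans (↭.↭-sym (↭P.↭-reverse (interval (k ℕ.+ e) k)))
      (↭-reflexive (trans (reverse-interval (k ℕ.+ e) k) (cong (λ z → map (suc z ∸_) U) (sym D'≡))))

  at : Tag → ℕ → ℕ → Label
  at t m v = ((m , v) , t)

  mirror : ℕ → ℕ → Label
  mirror m v = ((m , D ∸ v) , plain)

  plainBlock pairedBlock : ℕ → List Label
  plainBlock m = map (at plain m) U ++ map (at plain m) Mid ++ map (mirror m) U
  pairedBlock m = map (at halfSum m) U ++ map (at plain m) Mid ++ map (at halfDiff m) U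

  pairFactor : ℚ
  pairFactor = (- ½) ^ℚ k

  detL-pairedBlock : ∀ m xs P Q → detL entry± xs (P ++ pairedBlock m ++ Q) ≡ pairFactor * detL entry± xs (P ++ plainBlock m ++ Q)
  detL-pairedBlock m xs P Q = begin
    detL entry± xs (P ++ (S ++ M ++ Δ) ++ Q)      ≡⟨ cong (detL entry± xs) (reassocˡ P S M Δ Q) ⟩
    detL entry± xs ((P ++ S ++ M) ++ Δ ++ Q)
      ≡⟨ detL-addColumns entry± (mirror m) (at halfDiff m) (at halfSum m) (- 1ℚ) 1ℚ halfDiff≡ xs (P ++ S ++ M) U Q
           (λ u u∈U → inj₁ (∈-++⁺ʳ P (∈-++⁺ˡ (∈-map⁺ (at halfSum m) u∈U)))) ⟩
    (- 1ℚ) ^ℚ length U * detL entry± xs ((P ++ S ++ M) ++ H ++ Q)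
      ≡⟨ cong₂ (λ z l → (- 1ℚ) ^ℚ z * detL entry± xs l) (length-interval 0 k) (reassocʳ P S M H Q) ⟩
    (- 1ℚ) ^ℚ k * detL entry± xs (P ++ S ++ (M ++ H ++ Q))
      ≡⟨ cong ((- 1ℚ) ^ℚ k *_) (detL-addColumns entry± (at plain m) (at halfSum m) (mirror m) ½ ½ halfSum≡ xs P U (M ++ H ++ Q)
           (λ u u∈U → inj₂ (∈-++⁺ʳ M (∈-++⁺ˡ (∈-map⁺ (mirror m) u∈U))))) ⟩
    (- 1ℚ) ^ℚ k * (½ ^ℚ length U * detL entry± xs (P ++ map (at plain m) U ++ (M ++ H ++ Q)))
      ≡⟨ cong (λ z → (- 1ℚ) ^ℚ k * (½ ^ℚ z * detL entry± xs (P ++ map (at plain m) U ++ (M ++ H ++ Q)))) (length-interval 0 k) ⟩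
    (- 1ℚ) ^ℚ k * (½ ^ℚ k * detL entry± xs (P ++ map (at plain m) U ++ (M ++ H ++ Q)))
      ≡⟨ trans (sym (*-assoc ((- 1ℚ) ^ℚ k) (½ ^ℚ k) _)) (cong (_* detL entry± xs (P ++ map (at plain m) U ++ (M ++ H ++ Q))) (^ℚ-distrib-* (- 1ℚ) ½ k)) ⟩
    pairFactor * detL entry± xs (P ++ map (at plain m) U ++ (M ++ H ++ Q))
      ≡⟨ cong (λ l → pairFactor * detL entry± xs (P ++ l)) (sym (trans (++-assoc (map (at plain m) U) (M ++ H) Q) (cong (map (at plain m) U ++_) (++-assoc M H Q)))) ⟩
    pairFactor * detL entry± xs (P ++ plainBlock m ++ Q) ∎
    where
    open ≡-Reasoning
    S M Δ H : List Label
    S = map (at halfSum m) U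
    M = map (at plain m) Mid
    Δ = map (at halfDiff m) U
    H = map (mirror m) U
    reassocˡ : ∀ {X : Set} (P A B Z Q : List X) → P ++ (A ++ B ++ Z) ++ Q ≡ (P ++ A ++ B) ++ Z ++ Q
    reassocˡ P A B Z Q = trans (cong (P ++_) (trans (++-assoc A (B ++ Z) Q) (cong (A ++_) (++-assoc B Z Q))))
      (trans (cong (P ++_) (sym (++-assoc A B (Z ++ Q)))) (sym (++-assoc P (A ++ B) (Z ++ Q))))
    reassocʳ : ∀ {X : Set} (P A B Z Q : List X) → (P ++ A ++ B) ++ Z ++ Q ≡ P ++ A ++ (B ++ Z ++ Q)
    reassocʳ P A B Z Q = trans (++-assoc P (A ++ B) (Z ++ Q)) (cong (P ++_) (++-assoc A B (Z ++ Q)))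
    halfDiff≡ : ∀ u x → entry± x (at halfDiff m u) ≡ - 1ℚ * entry± x (mirror m u) + 1ℚ * entry± x (at halfSum m u)
    halfDiff≡ u x = solve 2 (λ a c → con ½ :* (a :- c) := (:- con 1ℚ) :* c :+ con 1ℚ :* (con ½ :* (a :+ c))) refl
      (entry D x (m , u)) (entry D x (m , D ∸ u))
    halfSum≡ : ∀ u x → entry± x (at halfSum m u) ≡ ½ * entry± x (at plain m u) + ½ * entry± x (mirror m u)
    halfSum≡ u x = solve 2 (λ a c → con ½ :* (a :+ c) := con ½ :* a :+ con ½ :* c) refl (entry D x (m , u)) (entry D x (m , D ∸ u))

  left right : Bool → ℕ → List Label
  left true m = map (at halfDiff m) U
  left false m = map (at halfSum m) U ++ map (at plain m) Mid
  right true m = map (at halfSum m) U ++ map (at plain m) Mid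
  right false m = map (at halfDiff m) U

  leftBlock rightBlock : ℕ → List Label
  leftBlock m = left (isEven m) m
  rightBlock m = right (isEven m) m

  pairedBlock↭ : ∀ b m → pairedBlock m ↭ left b m ++ right b m
  pairedBlock↭ true m = ↭-trans (↭-reflexive (sym (++-assoc (map (at halfSum m) U) _ _)))
    (↭P.++-comm (map (at halfSum m) U ++ map (at plain m) Mid) (map (at halfDiff m) U))
  pairedBlock↭ false m = ↭-reflexive (sym (++-assoc (map (at halfSum m) U) _ _))

  pairedBlocks↭ : ∀ l → concatMap pairedBlock l ↭ concatMap leftBlock l ++ concatMap rightBlock l
  pairedBlocks↭ l = ↭-trans (concatMap-↭ l (λ m → pairedBlock↭ (isEven m) m)) (concatMap-++-↭ leftBlock rightBlock l)

  plainLabel : ℕ × ℕ → Label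
  plainLabel c = (c , plain)

  colsΔ↭plainBlocks : ∀ r → map plainLabel (colsΔ r D) ↭ concatMap plainBlock (upTo r)
  colsΔ↭plainBlocks r = ↭-trans (↭-reflexive (map-concatMap plainLabel _ (upTo r))) (concatMap-↭ (upTo r) block↭)
    where
    block↭ : ∀ m → map plainLabel (map (m ,_) (oneTo D')) ↭ plainBlock m
    block↭ m = ↭-trans (↭-reflexive (trans (sym (map-∘ (oneTo D'))) (cong (map (at plain m)) (oneTo≡interval D'))))
      (↭-trans (↭P.map⁺ (at plain m) interval-split-mirror)
        (↭-reflexive (trans (map-++ (at plain m) U _)
          (cong (map (at plain m) U ++_) (trans (map-++ (at plain m) Mid _) (cong (map (at plain m) Mid ++_) (sym (map-∘ U))))))))

  oneTo-kk : oneTo (kk D) ≡ U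
  oneTo-kk = trans (cong oneTo kk≡) (oneTo≡interval k)

  oneTo-kbar : oneTo (kbar D) ≡ U ++ Mid
  oneTo-kbar = trans (cong oneTo kbar≡) (trans (oneTo≡interval (k ℕ.+ e)) (interval-+ 0 k e))

  columns-halves : ∀ m t t' → map proj₁ (map (at t m) U ++ map (at t' m) Mid) ≡ map (m ,_) (oneTo (kbar D))
  columns-halves m t t' = trans (map-++ proj₁ (map (at t m) U) _)
    (trans (cong₂ _++_ (sym (map-∘ U)) (sym (map-∘ Mid))) (trans (sym (map-++ (m ,_) U Mid)) (cong (map (m ,_)) (sym oneTo-kbar))))

  columns-U : ∀ m t → map proj₁ (map (at t m) U) ≡ map (m ,_) (oneTo (kk D))
  columns-U m t = trans (sym (map-∘ U)) (cong (map (m ,_)) (sym oneTo-kk))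

  leftBlocks-columns : ∀ r → map proj₁ (concatMap leftBlock (upTo r)) ≡ colsΔ′ r D
  leftBlocks-columns r = trans (map-concatMap proj₁ leftBlock (upTo r)) (concatMap-cong (λ m → columns (isEven m) m) (upTo r))
    where
    columns : ∀ b m → map proj₁ (left b m) ≡ map (m ,_) (oneTo (if b then kk D else kbar D))
    columns true m = columns-U m halfDiff
    columns false m = columns-halves m halfSum plain

  rightBlocks-columns : ∀ r → map proj₁ (concatMap rightBlock (upTo r)) ≡ colsΔ″ r D
  rightBlocks-columns r = trans (map-concatMap proj₁ rightBlock (upTo r)) (concatMap-cong (λ m → columns (isEven m) m) (upTo r))
    where
    columns : ∀ b m → map proj₁ (right b m) ≡ map (m ,_) (oneTo (if b then kbar D else kk D))
    columns true m = columns-halves m halfSum plain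
    columns false m = columns-U m halfDiff

  length-leftBlocks : ∀ r → length (concatMap leftBlock (upTo r)) ≡ NN r D
  length-leftBlocks r = trans (length-concatMap-alternating leftBlock k e e≤1 (λ m → length-left (isEven m) m) r id (λ _ → refl))
    (cong (λ z → ⌊ z ℕ.* r /2⌋) (trans (ℕP.+-comm k (k ℕ.+ e)) (sym D'≡)))
    where
    length-left : ∀ b m → length (left b m) ≡ (if b then k else k ℕ.+ e)
    length-left true m = trans (length-map (at halfDiff m) U) (length-interval 0 k)
    length-left false m = trans (length-++ (map (at halfSum m) U))
      (cong₂ ℕ._+_ (trans (length-map (at halfSum m) U) (length-interval 0 k)) (trans (length-map (at plain m) Mid) (length-interval k e)))

  Agrees Vanishes : (ℕ → Set) → Label → Set
  Agrees Row c = ∀ x → Row x → entry D x (proj₁ c) ≡ entry± x c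
  Vanishes Row c = ∀ x → Row x → entry± x c ≡ 0ℚ

  private
    2≤+ : ∀ x m → 2 ≤ x → 2 ≤ x ℕ.+ m
    2≤+ x m 2≤x = ℕP.≤-trans 2≤x (ℕP.m≤m+n x m)

    on-U : ∀ {P : Label → Set} t m → (∀ v → v ≤ D → P (at t m v)) → All P (map (at t m) U)
    on-U t m P-v = AllP.map⁺ (All.map (λ {v} → P-v v) U-bounded)

    agrees-Mid : ∀ Row m → All (Agrees Row) (map (at plain m) Mid)
    agrees-Mid Row m = AllP.map⁺ (All.universal (λ v x _ → refl) Mid)

  left-agrees : ∀ b m → isEven m ≡ b → All (Agrees OddRow) (left b m)
  left-agrees true m m-even = on-U halfDiff m λ v v≤D x (x-odd , 2≤x) →
    sym (halfDiff-odd x m v v≤D (trans (isEven-+-odd x m x-odd) (cong not m-even)) (2≤+ x m 2≤x))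
  left-agrees false m m-odd = AllP.++⁺ (on-U halfSum m λ v v≤D x (x-odd , _) →
    sym (halfSum-even x m v v≤D (trans (isEven-+-odd x m x-odd) (cong not m-odd)))) (agrees-Mid OddRow m)

  right-agrees : ∀ b m → isEven m ≡ b → All (Agrees EvenRow) (right b m)
  right-agrees true m m-even = AllP.++⁺ (on-U halfSum m λ v v≤D x (x-even , _) →
    sym (halfSum-even x m v v≤D (trans (isEven-+-even x m x-even) m-even))) (agrees-Mid EvenRow m)
  right-agrees false m m-odd = on-U halfDiff m λ v v≤D x (x-even , 2≤x) →
    sym (halfDiff-odd x m v v≤D (trans (isEven-+-even x m x-even) m-odd) (2≤+ x m 2≤x))

  right-vanishes : ∀ b m → isEven m ≡ b → All (Vanishes OddRow) (right b m)
  right-vanishes true m m-even = AllP.++⁺ (on-U halfSum m λ v v≤D x (x-odd , 2≤x) →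
      halfSum-odd x m v v≤D (trans (isEven-+-odd x m x-odd) (cong not m-even)) (2≤+ x m 2≤x))
    (AllP.map⁺ (All.map (λ {v} mirror x (x-odd , 2≤x) →
      self-mirror-odd x m v mirror (trans (isEven-+-odd x m x-odd) (cong not m-even)) (2≤+ x m 2≤x))
      (interval-self-mirror k e D' e≤1 D'≡)))
  right-vanishes false m m-odd = on-U halfDiff m λ v v≤D x (x-odd , _) →
    halfDiff-even x m v v≤D (trans (isEven-+-odd x m x-odd) (cong not m-odd))

  detL-relabel : ∀ Row xs (L : List Label) cs → map proj₁ L ≡ cs → All Row xs → All (Agrees Row) L →
                 detL (entry D) xs cs ≡ detL entry± xs L
  detL-relabel Row xs L cs L≡cs rows-ok agree = begin
    detL (entry D) xs cs                          ≡⟨ cong (detL (entry D) xs) (sym L≡cs) ⟩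
    detL (entry D) xs (map proj₁ L)               ≡⟨ detL-map (entry D) proj₁ xs L ⟩
    detL (λ x c → entry D x (proj₁ c)) xs L       ≡⟨ detL-cong _ entry± Row (Agrees Row) (λ x c row ok → ok x row) xs L rows-ok agree ⟩
    detL entry± xs L                              ∎
    where open ≡-Reasoning

  pairInverse : ℚ
  pairInverse = (- ℕtoℚ 2) ^ℚ k

  factor : ℕ → ℚ
  factor r = sgn (swaps (colsΔ↭plainBlocks r)) * (pairInverse ^ℚ r * sgn (swaps (pairedBlocks↭ (upTo r))))

  pairInverse-inverse : ∀ r → pairInverse ^ℚ r * pairFactor ^ℚ r ≡ 1ℚ
  pairInverse-inverse = ^ℚ-inverse (^ℚ-inverse refl k)

  factor-≢0 : ∀ r → factor r ≢ 0ℚ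
  factor-≢0 r = x#0y#0→xy#0 (sgn-≢0 (swaps (colsΔ↭plainBlocks r)))
    (x#0y#0→xy#0 (inverse⇒≢0 {pairInverse ^ℚ r} {pairFactor ^ℚ r} (pairInverse-inverse r)) (sgn-≢0 (swaps (pairedBlocks↭ (upTo r)))))

  module _ (r : ℕ) (α : Fin (r ℕ.* D') → ℕ) where

    private
      rows : List ℕ
      rows = rowsOf (r ℕ.* D') α
      N : ℕ
      N = NN r D
      L R : List Label
      L = concatMap leftBlock (upTo r)
      R = concatMap rightBlock (upTo r)

    detL-split : All OddRow (take N rows) → All EvenRow (drop N rows) →
                 detL entry± rows (L ++ R) ≡ Δ̃′ r D α * Δ̃″ r D α
    detL-split odd even = begin
      detL entry± rows (L ++ R)                           ≡⟨ cong (λ rs → detL entry± rs (L ++ R)) (sym (take++drop≡id N rows)) ⟩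
      detL entry± (take N rows ++ drop N rows) (L ++ R)
        ≡⟨ detL-blockTriangular entry± OddRow (Vanishes OddRow) (λ x c odd-x vanishes → vanishes x odd-x)
             (take N rows) (drop N rows) L R length-odd odd (All-concatMap rightBlock (upTo r) (λ m → right-vanishes (isEven m) m refl)) ⟩
      detL entry± (take N rows) L * detL entry± (drop N rows) R
        ≡⟨ cong₂ _*_ (sym (detL-relabel OddRow (take N rows) L (colsΔ′ r D) (leftBlocks-columns r) odd
                             (All-concatMap leftBlock (upTo r) (λ m → left-agrees (isEven m) m refl))))
                     (sym (detL-relabel EvenRow (drop N rows) R (colsΔ″ r D) (rightBlocks-columns r) even
                             (All-concatMap rightBlock (upTo r) (λ m → right-agrees (isEven m) m refl)))) ⟩
      Δ̃′ r D α * Δ̃″ r D α                                 ∎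
      where
      open ≡-Reasoning
      length-odd : length (take N rows) ≡ length L
      length-odd = trans (length-take N rows) (trans (cong (N ℕ.⊓_) (trans (length-map α (List.allFin _)) (length-tabulate id)))
        (trans (ℕP.m≤n⇒m⊓n≡m (ℕP.≤-trans (ℕP.⌊n/2⌋≤n (D' ℕ.* r)) (ℕP.≤-reflexive (ℕP.*-comm D' r))))
          (sym (length-leftBlocks r))))

    Δ̃-factorises : All OddRow (take N rows) → All EvenRow (drop N rows) →
                   Δ̃ r D α ≡ (factor r * Δ̃′ r D α) * Δ̃″ r D α
    Δ̃-factorises odd even = begin
      Δ̃ r D α                                                  ≡⟨ sym (detL-map entry± plainLabel rows (colsΔ r D)) ⟩
      detL entry± rows (map plainLabel (colsΔ r D))            ≡⟨ detL-↭ entry± (colsΔ↭plainBlocks r) rows ⟩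
      σ₁ * detL entry± rows (concatMap plainBlock (upTo r))    ≡⟨ cong (σ₁ *_) (y≡b*x⇒x≡a*y {pairInverse ^ℚ r} {pairFactor ^ℚ r} (pairInverse-inverse r) paired≡) ⟩
      σ₁ * (ι * detL entry± rows (concatMap pairedBlock (upTo r)))
        ≡⟨ cong (λ z → σ₁ * (ι * z)) (detL-↭ entry± (pairedBlocks↭ (upTo r)) rows) ⟩
      σ₁ * (ι * (σ₂ * detL entry± rows (L ++ R)))             ≡⟨ cong (λ z → σ₁ * (ι * (σ₂ * z))) (detL-split odd even) ⟩
      σ₁ * (ι * (σ₂ * (Δ̃′ r D α * Δ̃″ r D α)))
        ≡⟨ solve 5 (λ s i t a b → s :* (i :* (t :* (a :* b))) := (s :* (i :* t)) :* a :* b) refl σ₁ ι σ₂ (Δ̃′ r D α) (Δ̃″ r D α) ⟩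
      (factor r * Δ̃′ r D α) * Δ̃″ r D α                         ∎
      where
      open ≡-Reasoning
      σ₁ σ₂ ι : ℚ
      σ₁ = sgn (swaps (colsΔ↭plainBlocks r))
      σ₂ = sgn (swaps (pairedBlocks↭ (upTo r)))
      ι = pairInverse ^ℚ r
      paired≡ : detL entry± rows (concatMap pairedBlock (upTo r)) ≡ pairFactor ^ℚ r * detL entry± rows (concatMap plainBlock (upTo r))
      paired≡ = trans (detL-concatMap entry± pairedBlock plainBlock pairFactor detL-pairedBlock (upTo r) rows)
        (cong (λ z → pairFactor ^ℚ z * detL entry± rows (concatMap plainBlock (upTo r))) (length-upTo r))


proposition3p4 : (r D : ℕ) → 1 ≤ r → 3 ≤ D →
    Σ ℚ (λ C → C ≢ 0ℚ ×
      ((α : Fin (r ℕ.* (D ∸ 1)) → ℕ) →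
        (∀ i j → i Fin.< j → α i < α j) →
        (∀ t → toℕ t ≡ 0 → 2 ≤ α t) →
        (∀ t → toℕ t < NN r D → α t ℕ.% 2 ≡ 1) →
        (∀ t → NN r D ≤ toℕ t → α t ℕ.% 2 ≡ 0) →
        (Δ̃ r D α ≡ (C * Δ̃′ r D α) * Δ̃″ r D α)
        × (Δ̃′ r D α ≢ 0ℚ → Δ̃″ r D α ≢ 0ℚ → Δ̃ r D α ≢ 0ℚ)))
-- The argument only uses D ≥ 1.
proposition3p4 r zero _ ()
proposition3p4 r (suc D') _ _ = factor r , factor-≢0 r , λ α increasing first≥2 odd even →
  let (odd-rows , even-rows) = rows-parity (NN r (suc D')) α increasing first≥2 odd even
      Δ̃≡ = Δ̃-factorises r α odd-rows even-rows
  in Δ̃≡ , λ Δ̃′≢0 Δ̃″≢0 Δ̃≡0 → x#0y#0→xy#0 (x#0y#0→xy#0 (factor-≢0 r) Δ̃′≢0) Δ̃″≢0 (trans (sym Δ̃≡) Δ̃≡0)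
  where
  halves : Σ ℕ (λ e → e ≤ 1 × ⌈ D' /2⌉ ≡ ⌊ D' /2⌋ ℕ.+ e)
  halves = ⌈n/2⌉≡⌊n/2⌋+parity D'
  e : ℕ
  e = proj₁ halves
  kbar≡ : kbar (suc D') ≡ kk (suc D') ℕ.+ e
  kbar≡ = proj₂ (proj₂ halves)
  D'≡ : D' ≡ kk (suc D') ℕ.+ e ℕ.+ kk (suc D')
  D'≡ = trans (sym (ℕP.⌊n/2⌋+⌈n/2⌉≡n D')) (trans (cong (kk (suc D') ℕ.+_) kbar≡) (ℕP.+-comm (kk (suc D')) (kk (suc D') ℕ.+ e)))
  open Pairing D' (kk (suc D')) e (proj₁ (proj₂ halves)) D'≡ refl kbar≡
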